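{- Let $n$ and $j$ be positive integers. Then \[ \sum_{\substack{0\le k\le n\\ n-k \text{ even}}} \binom{n}{k}\big(2^k L_{jk}-2L_j^k\big)(\sqrt5 F_j)^{n-k}\frac{B_{n-k+2}}{n-k+2}=\frac{2^{n+2}L_{j(n+2)}-2L_j^{n+2}}{5(n+1)(n+2)F_j^2}-L_j^n, \] \[ \sum_{\substack{0\le k\le n\\ n-k \text{ even}}} \binom{n}{k}\big(2^k L_{jk}+2L_j^k\big)(\sqrt5 F_j)^{n-k}\frac{2^{n-k+2}-1}{n-k+2}B_{n-k+2}=L_j^n, \] and \[ \sum_{\substack{0\le k\le n\\ n-k \text{ even}}} \binom{n}{k}2^k F_{jk}(\sqrt5F_j)^{n-k}\frac{B_{n-k+2}}{n-k+2}+\frac{2}{\sqrt5}\sum_{\substack{0\le k\le n-1\\ n-k \text{ odd}}}\binom{n}{k}L_j^k(\sqrt5F_j)^{n-k}\frac{B_{n-k+1}}{n-k+1} =\frac{2^{n+2}F_{j(n+2)}}{5(n+1)(n+2)F_j^2}-\frac{2L_j^{n+1}}{5(n+1)F_j}. \]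
   Context: $F_n$ and $L_n$ denote the Fibonacci and Lucas numbers: $F_0=0,F_1=1$, $L_0=2,L_1=1$, and $u_n=u_{n-1}+u_{n-2}$. The Bernoulli numbers $B_n$ are defined by $\sum_{n\ge0}B_n\frac{z^n}{n!}=\frac{z}{e^z-1}$ (so $B_0=1$, $B_1=-\tfrac12$, $B_2=\tfrac16$, $B_{2n+1}=0$ for $n\ge1$). -}

module Defs where

open import Data.Nat as ℕ using (ℕ; zero; suc; _∸_; _≤ᵇ_)
open import Data.Nat.Combinatorics using (_C_)
open import Data.Bool using (Bool; true; false; if_then_else_)
open import Data.Integer using (+_)
open import Data.Rational as ℚ using (ℚ; 0ℚ; 1ℚ; _+_; _*_; -_; _÷_; ≢-nonZero)
open import Data.Rational.Properties using (_≟_)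
open import Relation.Nullary using (yes; no)

F : ℕ → ℕ
F 0 = 0
F 1 = 1
F (suc (suc n)) = F (suc n) ℕ.+ F n

L : ℕ → ℕ
L 0 = 2
L 1 = 1
L (suc (suc n)) = L (suc n) ℕ.+ L n

ι : ℕ → ℚ
ι n = (+ n) ℚ./ 1

-- total division on ℚ (x / 0 := 0); only ever applied to nonzero divisors here
_/'_ : ℚ → ℚ → ℚ
p /' q with q ≟ 0ℚ
... | yes _ = 0ℚ
... | no q≢0 = _÷_ p q {{≢-nonZero q≢0}}

Σ≤ : ℕ → (ℕ → ℚ) → ℚ
Σ≤ zero f = f 0
Σ≤ (suc n) f = Σ≤ n f + f (suc n)

-- Bernoulli numbers (B_1 = -1/2) via  B_0 = 1,
--   B_m = -(1/(m+1)) Σ_{k=0}^{m-1} C(m+1,k) B_k   (m ≥ 1),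
-- equivalent to Σ B_n z^n/n! = z/(e^z - 1).
-- bt m k = B_k for k ≤ m.
bt : ℕ → ℕ → ℚ
bt zero _ = 1ℚ
bt (suc m) k = if k ≤ᵇ m then bt m k else b
  where
  b = - ((1ℚ /' ι (suc (suc m))) * Σ≤ m (λ i → ι (suc (suc m) C i) * bt m i))

B : ℕ → ℚ
B m = bt m m

-- The field ℚ(√5): a + b√5 represented as (a , b)
record Q5 : Set where
  constructor _+√5·_
  field
    re : ℚ
    im : ℚ
open Q5 public

infixl 6 _⊕_
infixl 7 _⊗_
_⊕_ : Q5 → Q5 → Q5
(a +√5· b) ⊕ (c +√5· d) = (a + c) +√5· (b + d)

_⊗_ : Q5 → Q5 → Q5
(a +√5· b) ⊗ (c +√5· d) = (a * c + ι 5 * (b * d)) +√5· (a * d + b * c)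

⊖_ : Q5 → Q5
⊖ (a +√5· b) = (- a) +√5· (- b)

_⊖_ : Q5 → Q5 → Q5
x ⊖ y = x ⊕ (⊖ y)

⟦_⟧ : ℚ → Q5
⟦ q ⟧ = q +√5· 0ℚ

√5 : Q5
√5 = 0ℚ +√5· 1ℚ

_^5_ : Q5 → ℕ → Q5
x ^5 zero = ⟦ 1ℚ ⟧
x ^5 suc n = x ⊗ (x ^5 n)

_⊘_ : Q5 → ℚ → Q5
(a +√5· b) ⊘ q = (a /' q) +√5· (b /' q)

-- 1/√5 = √5/5
inv√5 : Q5
inv√5 = 0ℚ +√5· (1ℚ /' ι 5)

isEven : ℕ → Bool
isEven zero = true
isEven (suc n) = if isEven n then false else true

ΣQ5 : ℕ → (ℕ → Q5) → Q5
ΣQ5 zero f = f 0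
ΣQ5 (suc n) f = ΣQ5 n f ⊕ f (suc n)

ΣEven : ℕ → (ℕ → Q5) → Q5
ΣEven n f = ΣQ5 n (λ k → if isEven (n ∸ k) then f k else ⟦ 0ℚ ⟧)

ΣOdd : ℕ → (ℕ → Q5) → Q5
ΣOdd n f = ΣQ5 n (λ k → if isEven (n ∸ k) then ⟦ 0ℚ ⟧ else f k)

-- Put P = L_j + √5 F_j, M = L_j − √5 F_j and D = √5 F_j in ℚ(√5).  By Binet, P = 2φ^j and M = 2ψ^j, so
-- 2^k L_{jk} = P^k + M^k and √5 · 2^k F_{jk} = P^k − M^k.  Each left-hand side is therefore a binomial
-- convolution Σ_k C(n,k) a_k D^{n-k} c_{n-k} with a_k a combination of P^k, M^k, L_j^k.  Expanding
-- P^k = (L_j + D)^k and M^k = (L_j − D)^k turns it into Σ_r C(n,r) L_j^{n-r} D^r κ_r, where κ_r involves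
-- only the binomial sums Σ_i C(r,i) c_i of the Bernoulli weights c.  Those sums have closed forms, which
-- follow from the recurrence B_m(1) = B_m + [m = 1], the vanishing of B_{2k+1} (k ≥ 1) and the duplication
-- formula; the last two are generating-function identities, proved by showing that the difference h of
-- their two sides satisfies h ⋆ 𝟏 = h, which forces h = 0.  The
-- right-hand sides are the same convolutions, read off from the binomial expansion of P^{n+2} ± M^{n+2}
-- after dividing out (n+1)(n+2)D² = 5(n+1)(n+2)F_j².

module Submission where

open import Defs
open import Data.Nat as N using (ℕ; zero; suc; _∸_; _≤_; _<_; z≤n; s≤s)
import Data.Nat.Properties as N
open import Data.Nat.Combinatorics using (_C_; nCk+nC[k+1]≡[n+1]C[k+1]; k>n⇒nCk≡0; nCn≡1; nCk≡nC[n∸k]; nC1≡n)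
open import Data.Nat.Tactic.RingSolver using () renaming (solve-∀ to ℕ-solve-∀)
open import Data.Integer as ℤ using (+_)
import Data.Integer.Properties as ℤ
open import Data.Rational as ℚ using (ℚ; 0ℚ; 1ℚ; ½; _+_; _*_; _-_; -_)
import Data.Rational.Properties as ℚ
import Data.Rational.Unnormalised as ℚᵘ
import Data.Rational.Unnormalised.Properties as ℚᵘ
import Data.Nat.Coprimality as Coprimality
open import Data.Bool using (true; false; if_then_else_)
open import Data.Maybe using (Maybe; just; nothing)
open import Data.Product using (_,_; _×_)
open import Data.Sum using (inj₁; inj₂)
open import Data.Unit using (tt)
open import Data.Empty using (⊥-elim)
open import Function using (_∘_)
open import Level using (0ℓ)
open import Algebra using (CommutativeRing; IsCommutativeRing)
open import Relation.Nullary using (yes; no)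
open import Relation.Binary.PropositionalEquality
open import Tactic.RingSolver using (solve-∀)
open import Tactic.RingSolver.Core.AlmostCommutativeRing using (AlmostCommutativeRing; fromCommutativeRing)

ℚ-ring : AlmostCommutativeRing 0ℓ 0ℓ
ℚ-ring = fromCommutativeRing ℚ.+-*-commutativeRing isZero
  where
  isZero : (x : ℚ) → Maybe (0ℚ ≡ x)
  isZero x with 0ℚ ℚ.≟ x
  ... | yes p = just p
  ... | no _ = nothing

private
  toℚᵘ-ι : ∀ n → ℚ.toℚᵘ (ι n) ≡ ℚᵘ.mkℚᵘ (+ n) 0
  toℚᵘ-ι n = cong ℚ.toℚᵘ (ℚ.normalize-coprime (Coprimality.sym (Coprimality.1-coprimeTo n)))

ι-+ : ∀ a b → ι (a N.+ b) ≡ ι a + ι b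
ι-+ a b = ℚ.toℚᵘ-injective (begin
    ℚ.toℚᵘ (ι (a N.+ b))              ≡⟨ toℚᵘ-ι (a N.+ b) ⟩
    ℚᵘ.mkℚᵘ (+ (a N.+ b)) 0           ≈⟨ ℚᵘ.*≡* (cong (ℤ._* + 1) (cong₂ ℤ._+_ (sym (ℤ.*-identityʳ (+ a))) (sym (ℤ.*-identityʳ (+ b))))) ⟩
    ℚᵘ.mkℚᵘ (+ a) 0 ℚᵘ.+ ℚᵘ.mkℚᵘ (+ b) 0 ≡⟨ sym (cong₂ ℚᵘ._+_ (toℚᵘ-ι a) (toℚᵘ-ι b)) ⟩
    ℚ.toℚᵘ (ι a) ℚᵘ.+ ℚ.toℚᵘ (ι b)    ≈⟨ ℚᵘ.≃-sym (ℚ.toℚᵘ-homo-+ (ι a) (ι b)) ⟩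
    ℚ.toℚᵘ (ι a + ι b)                ∎)
  where open ℚᵘ.≃-Reasoning

ι-* : ∀ a b → ι (a N.* b) ≡ ι a * ι b
ι-* a b = ℚ.toℚᵘ-injective (begin
    ℚ.toℚᵘ (ι (a N.* b))              ≡⟨ toℚᵘ-ι (a N.* b) ⟩
    ℚᵘ.mkℚᵘ (+ (a N.* b)) 0           ≈⟨ ℚᵘ.*≡* (cong (ℤ._* + 1) (ℤ.pos-* a b)) ⟩
    ℚᵘ.mkℚᵘ (+ a) 0 ℚᵘ.* ℚᵘ.mkℚᵘ (+ b) 0 ≡⟨ sym (cong₂ ℚᵘ._*_ (toℚᵘ-ι a) (toℚᵘ-ι b)) ⟩
    ℚ.toℚᵘ (ι a) ℚᵘ.* ℚ.toℚᵘ (ι b)    ≈⟨ ℚᵘ.≃-sym (ℚ.toℚᵘ-homo-* (ι a) (ι b)) ⟩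
    ℚ.toℚᵘ (ι a * ι b)                ∎)
  where open ℚᵘ.≃-Reasoning

ι-nonZero : ∀ m → m ≢ 0 → ι m ≢ 0ℚ
ι-nonZero zero m≢0 _ = m≢0 refl
ι-nonZero (suc m) _ ιm≡0 with trans (sym (toℚᵘ-ι (suc m))) (cong ℚ.toℚᵘ ιm≡0)
... | ()

-- The coefficient 5 of √5 · √5 is abstracted as `five` so that the solver does not need to normalise ι 5.
private
  module Components where
    +-assoc : ∀ (a b c : ℚ) → (a + b) + c ≡ a + (b + c)
    +-assoc = solve-∀ ℚ-ring
    +-comm : ∀ (a b : ℚ) → a + b ≡ b + a
    +-comm = solve-∀ ℚ-ring
    +-identityˡ : ∀ (a : ℚ) → 0ℚ + a ≡ a
    +-identityˡ = solve-∀ ℚ-ring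
    +-inverseˡ : ∀ (a : ℚ) → (- a) + a ≡ 0ℚ
    +-inverseˡ = solve-∀ ℚ-ring
    *-assoc-re : ∀ (five a b c d e f : ℚ) →
      (a * c + five * (b * d)) * e + five * ((a * d + b * c) * f) ≡ a * (c * e + five * (d * f)) + five * (b * (c * f + d * e))
    *-assoc-re = solve-∀ ℚ-ring
    *-assoc-im : ∀ (five a b c d e f : ℚ) →
      (a * c + five * (b * d)) * f + (a * d + b * c) * e ≡ a * (c * f + d * e) + b * (c * e + five * (d * f))
    *-assoc-im = solve-∀ ℚ-ring
    *-comm-re : ∀ (five a b c d : ℚ) → a * c + five * (b * d) ≡ c * a + five * (d * b)
    *-comm-re = solve-∀ ℚ-ring
    *-comm-im : ∀ (a b c d : ℚ) → a * d + b * c ≡ c * b + d * a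
    *-comm-im = solve-∀ ℚ-ring
    *-identityˡ-re : ∀ (five a b : ℚ) → 1ℚ * a + five * (0ℚ * b) ≡ a
    *-identityˡ-re = solve-∀ ℚ-ring
    *-identityˡ-im : ∀ (a b : ℚ) → 1ℚ * b + 0ℚ * a ≡ b
    *-identityˡ-im = solve-∀ ℚ-ring
    *-distribˡ-re : ∀ (five a b c d e f : ℚ) → a * (c + e) + five * (b * (d + f)) ≡ (a * c + five * (b * d)) + (a * e + five * (b * f))
    *-distribˡ-re = solve-∀ ℚ-ring
    *-distribˡ-im : ∀ (a b c d e f : ℚ) → a * (d + f) + b * (c + e) ≡ (a * d + b * c) + (a * f + b * e)
    *-distribˡ-im = solve-∀ ℚ-ring
    *-embed-re : ∀ (five a b : ℚ) → a * b ≡ a * b + five * (0ℚ * 0ℚ)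
    *-embed-re = solve-∀ ℚ-ring
    *-embed-im : ∀ (a b : ℚ) → 0ℚ ≡ a * 0ℚ + 0ℚ * b
    *-embed-im = solve-∀ ℚ-ring

open Components

⊕-assoc : ∀ x y z → (x ⊕ y) ⊕ z ≡ x ⊕ (y ⊕ z)
⊕-assoc (a +√5· b) (c +√5· d) (e +√5· f) = cong₂ _+√5·_ (+-assoc a c e) (+-assoc b d f)

⊕-comm : ∀ x y → x ⊕ y ≡ y ⊕ x
⊕-comm (a +√5· b) (c +√5· d) = cong₂ _+√5·_ (+-comm a c) (+-comm b d)

⊕-identityˡ : ∀ x → ⟦ 0ℚ ⟧ ⊕ x ≡ x
⊕-identityˡ (a +√5· b) = cong₂ _+√5·_ (+-identityˡ a) (+-identityˡ b)

⊕-inverseˡ : ∀ x → (⊖ x) ⊕ x ≡ ⟦ 0ℚ ⟧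
⊕-inverseˡ (a +√5· b) = cong₂ _+√5·_ (+-inverseˡ a) (+-inverseˡ b)

⊗-assoc : ∀ x y z → (x ⊗ y) ⊗ z ≡ x ⊗ (y ⊗ z)
⊗-assoc (a +√5· b) (c +√5· d) (e +√5· f) = cong₂ _+√5·_ (*-assoc-re (ι 5) a b c d e f) (*-assoc-im (ι 5) a b c d e f)

⊗-comm : ∀ x y → x ⊗ y ≡ y ⊗ x
⊗-comm (a +√5· b) (c +√5· d) = cong₂ _+√5·_ (*-comm-re (ι 5) a b c d) (*-comm-im a b c d)

⊗-identityˡ : ∀ x → ⟦ 1ℚ ⟧ ⊗ x ≡ x
⊗-identityˡ (a +√5· b) = cong₂ _+√5·_ (*-identityˡ-re (ι 5) a b) (*-identityˡ-im a b)

⊗-distribˡ-⊕ : ∀ x y z → x ⊗ (y ⊕ z) ≡ (x ⊗ y) ⊕ (x ⊗ z)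
⊗-distribˡ-⊕ (a +√5· b) (c +√5· d) (e +√5· f) = cong₂ _+√5·_ (*-distribˡ-re (ι 5) a b c d e f) (*-distribˡ-im a b c d e f)

⟦⟧-* : ∀ a b → ⟦ a * b ⟧ ≡ ⟦ a ⟧ ⊗ ⟦ b ⟧
⟦⟧-* a b = cong₂ _+√5·_ (*-embed-re (ι 5) a b) (*-embed-im a b)

ℚ√5-isCommutativeRing : IsCommutativeRing _≡_ _⊕_ _⊗_ ⊖_ ⟦ 0ℚ ⟧ ⟦ 1ℚ ⟧
ℚ√5-isCommutativeRing = record
  { isRing = record
    { +-isAbelianGroup = record
      { isGroup = record
        { isMonoid = record
          { isSemigroup = record
            { isMagma = record { isEquivalence = isEquivalence ; ∙-cong = cong₂ _⊕_ }
            ; assoc = ⊕-assoc }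
          ; identity = ⊕-identityˡ , λ x → trans (⊕-comm x _) (⊕-identityˡ x) }
        ; inverse = ⊕-inverseˡ , λ x → trans (⊕-comm x _) (⊕-inverseˡ x)
        ; ⁻¹-cong = cong (λ x → ⊖ x) }
      ; comm = ⊕-comm }
    ; *-cong = cong₂ _⊗_
    ; *-assoc = ⊗-assoc
    ; *-identity = ⊗-identityˡ , λ x → trans (⊗-comm x _) (⊗-identityˡ x)
    ; distrib = ⊗-distribˡ-⊕ , λ x y z → trans (⊗-comm _ x) (trans (⊗-distribˡ-⊕ x y z) (cong₂ _⊕_ (⊗-comm x y) (⊗-comm x z))) }
  ; *-comm = ⊗-comm }

ℚ√5-commutativeRing : CommutativeRing 0ℓ 0ℓ
ℚ√5-commutativeRing = record { isCommutativeRing = ℚ√5-isCommutativeRing }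

ℚ√5 : AlmostCommutativeRing 0ℓ 0ℓ
ℚ√5 = fromCommutativeRing ℚ√5-commutativeRing isZero
  where
  isZero : (x : Q5) → Maybe (⟦ 0ℚ ⟧ ≡ x)
  isZero (a +√5· b) with 0ℚ ℚ.≟ a | 0ℚ ℚ.≟ b
  ... | yes p | yes q = just (cong₂ _+√5·_ p q)
  ... | _     | _     = nothing

𝟘 𝟙 : Q5
𝟘 = ⟦ 0ℚ ⟧
𝟙 = ⟦ 1ℚ ⟧

fromℕ : ℕ → Q5
fromℕ n = ⟦ ι n ⟧

infix 8 1/_
1/_ : ℕ → Q5
1/ m = ⟦ 1ℚ /' ι m ⟧

⊗-identityʳ : ∀ x → x ⊗ 𝟙 ≡ x
⊗-identityʳ = solve-∀ ℚ√5

⊗-zeroˡ : ∀ x → 𝟘 ⊗ x ≡ 𝟘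
⊗-zeroˡ = solve-∀ ℚ√5

⊗-zeroʳ : ∀ x → x ⊗ 𝟘 ≡ 𝟘
⊗-zeroʳ = solve-∀ ℚ√5

⊕-identityʳ : ∀ x → x ⊕ 𝟘 ≡ x
⊕-identityʳ = solve-∀ ℚ√5

fromℕ-+ : ∀ a b → fromℕ (a N.+ b) ≡ fromℕ a ⊕ fromℕ b
fromℕ-+ a b = cong ⟦_⟧ (ι-+ a b)

fromℕ-* : ∀ a b → fromℕ (a N.* b) ≡ fromℕ a ⊗ fromℕ b
fromℕ-* a b = trans (cong ⟦_⟧ (ι-* a b)) (⟦⟧-* (ι a) (ι b))

^5-+ : ∀ x a b → x ^5 (a N.+ b) ≡ x ^5 a ⊗ x ^5 b
^5-+ x zero b = sym (⊗-identityˡ (x ^5 b))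
^5-+ x (suc a) b = trans (cong (x ⊗_) (^5-+ x a b)) (sym (⊗-assoc x (x ^5 a) (x ^5 b)))

^5-* : ∀ x a b → x ^5 (a N.* b) ≡ (x ^5 a) ^5 b
^5-* x a zero = cong (x ^5_) (N.*-zeroʳ a)
^5-* x a (suc b) = begin
  x ^5 (a N.* suc b)            ≡⟨ cong (x ^5_) (N.*-suc a b) ⟩
  x ^5 (a N.+ a N.* b)          ≡⟨ ^5-+ x a (a N.* b) ⟩
  x ^5 a ⊗ x ^5 (a N.* b)       ≡⟨ cong (x ^5 a ⊗_) (^5-* x a b) ⟩
  x ^5 a ⊗ (x ^5 a) ^5 b        ∎
  where open ≡-Reasoning

⊗-^5 : ∀ x y n → (x ⊗ y) ^5 n ≡ x ^5 n ⊗ y ^5 n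
⊗-^5 x y zero = sym (⊗-identityˡ 𝟙)
⊗-^5 x y (suc n) = trans (cong ((x ⊗ y) ⊗_) (⊗-^5 x y n)) (interchange x y (x ^5 n) (y ^5 n))
  where
  interchange : ∀ a b c d → (a ⊗ b) ⊗ (c ⊗ d) ≡ (a ⊗ c) ⊗ (b ⊗ d)
  interchange = solve-∀ ℚ√5

𝟙^5 : ∀ n → 𝟙 ^5 n ≡ 𝟙
𝟙^5 zero = refl
𝟙^5 (suc n) = trans (⊗-identityˡ (𝟙 ^5 n)) (𝟙^5 n)

fromℕ-^ : ∀ a k → fromℕ (a N.^ k) ≡ fromℕ a ^5 k
fromℕ-^ a zero = refl
fromℕ-^ a (suc k) = trans (fromℕ-* a (a N.^ k)) (cong (fromℕ a ⊗_) (fromℕ-^ a k))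

⟦/'⟧ : ∀ p m → ⟦ p /' ι m ⟧ ≡ ⟦ p ⟧ ⊗ 1/ m
⟦/'⟧ p m = trans (cong ⟦_⟧ (/'≡*1/' p (ι m))) (⟦⟧-* p (1ℚ /' ι m))
  where
  /'≡*1/' : ∀ p q → p /' q ≡ p * (1ℚ /' q)
  /'≡*1/' p q with q ℚ.≟ 0ℚ
  ... | yes _ = sym (ℚ.*-zeroʳ p)
  ... | no _  = cong (p *_) (sym (ℚ.*-identityˡ _))

1/-inverseˡ : ∀ m → m ≢ 0 → 1/ m ⊗ fromℕ m ≡ 𝟙
1/-inverseˡ m m≢0 = trans (sym (⟦⟧-* (1ℚ /' ι m) (ι m))) (cong ⟦_⟧ (inverse (ι m) (ι-nonZero m m≢0)))
  where
  inverse : ∀ q → q ≢ 0ℚ → (1ℚ /' q) * q ≡ 1ℚ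
  inverse q q≢0 with q ℚ.≟ 0ℚ
  ... | yes q≡0 = ⊥-elim (q≢0 q≡0)
  ... | no q≢0′ = trans (cong (_* q) (ℚ.*-identityˡ (ℚ.1/_ q {{ℚ.≢-nonZero q≢0′}}))) (ℚ.*-inverseˡ q {{ℚ.≢-nonZero q≢0′}})

fromℕ-cancelˡ : ∀ m {x y} → m ≢ 0 → fromℕ m ⊗ x ≡ fromℕ m ⊗ y → x ≡ y
fromℕ-cancelˡ m {x} {y} m≢0 eq = begin
  x                               ≡⟨ sym (⊗-identityˡ x) ⟩
  𝟙 ⊗ x                           ≡⟨ cong (_⊗ x) (sym (1/-inverseˡ m m≢0)) ⟩
  (1/ m ⊗ fromℕ m) ⊗ x            ≡⟨ ⊗-assoc (1/ m) (fromℕ m) x ⟩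
  1/ m ⊗ (fromℕ m ⊗ x)            ≡⟨ cong (1/ m ⊗_) eq ⟩
  1/ m ⊗ (fromℕ m ⊗ y)            ≡⟨ sym (⊗-assoc (1/ m) (fromℕ m) y) ⟩
  (1/ m ⊗ fromℕ m) ⊗ y            ≡⟨ cong (_⊗ y) (1/-inverseˡ m m≢0) ⟩
  𝟙 ⊗ y                           ≡⟨ ⊗-identityˡ y ⟩
  y                               ∎
  where open ≡-Reasoning

fromℕ-quotient : ∀ a b {c} → b ≢ 0 → a N.* b ≡ c → fromℕ a ≡ fromℕ c ⊗ 1/ b
fromℕ-quotient a b {c} b≢0 ab≡c = begin
  fromℕ a                              ≡⟨ sym (⊗-identityʳ (fromℕ a)) ⟩
  fromℕ a ⊗ 𝟙                          ≡⟨ cong (fromℕ a ⊗_) (trans (sym (1/-inverseˡ b b≢0)) (⊗-comm (1/ b) (fromℕ b))) ⟩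
  fromℕ a ⊗ (fromℕ b ⊗ 1/ b)           ≡⟨ sym (⊗-assoc (fromℕ a) (fromℕ b) (1/ b)) ⟩
  (fromℕ a ⊗ fromℕ b) ⊗ 1/ b           ≡⟨ cong (_⊗ 1/ b) (trans (sym (fromℕ-* a b)) (cong fromℕ ab≡c)) ⟩
  fromℕ c ⊗ 1/ b                       ∎
  where open ≡-Reasoning

⊖≡𝟘⇒≡ : ∀ x y → x ⊖ y ≡ 𝟘 → x ≡ y
⊖≡𝟘⇒≡ x y x-y≡𝟘 = begin
  x                ≡⟨ sym (shift x y) ⟩
  (x ⊖ y) ⊕ y      ≡⟨ cong (_⊕ y) x-y≡𝟘 ⟩
  𝟘 ⊕ y            ≡⟨ ⊕-identityˡ y ⟩
  y                ∎
  where
  open ≡-Reasoning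
  shift : ∀ x y → (x ⊖ y) ⊕ y ≡ x
  shift = solve-∀ ℚ√5

ΣQ5-cong : ∀ n {f g : ℕ → Q5} → (∀ k → k ≤ n → f k ≡ g k) → ΣQ5 n f ≡ ΣQ5 n g
ΣQ5-cong zero eq = eq 0 z≤n
ΣQ5-cong (suc n) eq = cong₂ _⊕_ (ΣQ5-cong n (λ k k≤n → eq k (N.m≤n⇒m≤1+n k≤n))) (eq (suc n) N.≤-refl)

ΣQ5-unfoldˡ : ∀ n (f : ℕ → Q5) → ΣQ5 (suc n) f ≡ f 0 ⊕ ΣQ5 n (f ∘ suc)
ΣQ5-unfoldˡ zero f = refl
ΣQ5-unfoldˡ (suc n) f = trans (cong (_⊕ f (suc (suc n))) (ΣQ5-unfoldˡ n f)) (⊕-assoc (f 0) (ΣQ5 n (f ∘ suc)) (f (suc (suc n))))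

ΣQ5-⊕ : ∀ n (f g : ℕ → Q5) → ΣQ5 n (λ k → f k ⊕ g k) ≡ ΣQ5 n f ⊕ ΣQ5 n g
ΣQ5-⊕ zero f g = refl
ΣQ5-⊕ (suc n) f g = trans (cong (_⊕ (f (suc n) ⊕ g (suc n))) (ΣQ5-⊕ n f g)) (interchange (ΣQ5 n f) (ΣQ5 n g) (f (suc n)) (g (suc n)))
  where
  interchange : ∀ a b c d → (a ⊕ b) ⊕ (c ⊕ d) ≡ (a ⊕ c) ⊕ (b ⊕ d)
  interchange = solve-∀ ℚ√5

ΣQ5-⊗ : ∀ n c (f : ℕ → Q5) → ΣQ5 n (λ k → c ⊗ f k) ≡ c ⊗ ΣQ5 n f
ΣQ5-⊗ zero c f = refl
ΣQ5-⊗ (suc n) c f = trans (cong (_⊕ (c ⊗ f (suc n))) (ΣQ5-⊗ n c f)) (sym (⊗-distribˡ-⊕ c (ΣQ5 n f) (f (suc n))))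

ΣQ5-⊖ : ∀ n (f : ℕ → Q5) → ΣQ5 n (λ k → ⊖ f k) ≡ ⊖ ΣQ5 n f
ΣQ5-⊖ zero f = refl
ΣQ5-⊖ (suc n) f = trans (cong (_⊕ (⊖ f (suc n))) (ΣQ5-⊖ n f)) (⊖-distrib-⊕ (ΣQ5 n f) (f (suc n)))
  where
  ⊖-distrib-⊕ : ∀ a b → (⊖ a) ⊕ (⊖ b) ≡ ⊖ (a ⊕ b)
  ⊖-distrib-⊕ = solve-∀ ℚ√5

ΣQ5-zero : ∀ n {f : ℕ → Q5} → (∀ k → k ≤ n → f k ≡ 𝟘) → ΣQ5 n f ≡ 𝟘
ΣQ5-zero n {f} eq = trans (ΣQ5-cong n eq) (all-𝟘 n)
  where
  all-𝟘 : ∀ n → ΣQ5 n (λ _ → 𝟘) ≡ 𝟘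
  all-𝟘 zero = refl
  all-𝟘 (suc n) = trans (cong (_⊕ 𝟘) (all-𝟘 n)) (⊕-identityʳ 𝟘)

ΣQ5-reverse : ∀ n (f : ℕ → Q5) → ΣQ5 n f ≡ ΣQ5 n (λ k → f (n ∸ k))
ΣQ5-reverse zero f = refl
ΣQ5-reverse (suc n) f = begin
  ΣQ5 n f ⊕ f (suc n)                          ≡⟨ cong (_⊕ f (suc n)) (ΣQ5-reverse n f) ⟩
  ΣQ5 n (λ k → f (n ∸ k)) ⊕ f (suc n)          ≡⟨ ⊕-comm _ (f (suc n)) ⟩
  f (suc n) ⊕ ΣQ5 n (λ k → f (n ∸ k))          ≡⟨ sym (ΣQ5-unfoldˡ n (λ k → f (suc n ∸ k))) ⟩
  ΣQ5 (suc n) (λ k → f (suc n ∸ k))            ∎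
  where open ≡-Reasoning

C-absorb : ∀ n k → suc k N.* (suc n C suc k) ≡ suc n N.* (n C k)
C-absorb zero zero = refl
C-absorb zero (suc k) rewrite k>n⇒nCk≡0 {1} {suc (suc k)} (s≤s (s≤s z≤n)) | k>n⇒nCk≡0 {0} {suc k} (s≤s z≤n) = N.*-zeroʳ (suc (suc k))
C-absorb (suc m) k = begin
  suc k N.* (suc (suc m) C suc k)                              ≡⟨ cong (suc k N.*_) (sym (nCk+nC[k+1]≡[n+1]C[k+1] (suc m) k)) ⟩
  suc k N.* (suc m C k N.+ suc m C suc k)                      ≡⟨ N.*-distribˡ-+ (suc k) (suc m C k) (suc m C suc k) ⟩
  suc k N.* (suc m C k) N.+ suc k N.* (suc m C suc k)          ≡⟨ cong (suc k N.* (suc m C k) N.+_) (C-absorb m k) ⟩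
  suc k N.* (suc m C k) N.+ suc m N.* (m C k)                  ≡⟨ N.+-assoc (suc m C k) (k N.* (suc m C k)) (suc m N.* (m C k)) ⟩
  suc m C k N.+ (k N.* (suc m C k) N.+ suc m N.* (m C k))      ≡⟨ cong (suc m C k N.+_) (shifted k) ⟩
  suc (suc m) N.* (suc m C k)                                  ∎
  where
  open ≡-Reasoning
  shifted : ∀ k → k N.* (suc m C k) N.+ suc m N.* (m C k) ≡ suc m N.* (suc m C k)
  shifted zero = refl
  shifted (suc k) = begin
    suc k N.* (suc m C suc k) N.+ suc m N.* (m C suc k)  ≡⟨ cong (N._+ suc m N.* (m C suc k)) (C-absorb m k) ⟩
    suc m N.* (m C k) N.+ suc m N.* (m C suc k)          ≡⟨ sym (N.*-distribˡ-+ (suc m) (m C k) (m C suc k)) ⟩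
    suc m N.* (m C k N.+ m C suc k)                      ≡⟨ cong (suc m N.*_) (nCk+nC[k+1]≡[n+1]C[k+1] m k) ⟩
    suc m N.* (suc m C suc k)                            ∎

[1+n]Cn≡1+n : ∀ n → suc n C n ≡ suc n
[1+n]Cn≡1+n n = trans (nCk≡nC[n∸k] (N.n≤1+n n)) (trans (cong (suc n C_) (N.m+n∸n≡m 1 n)) (nC1≡n (suc n)))

-- (f ⋆ g) n is n! times the n-th coefficient of the product of the exponential generating functions of f and g;
-- δ₀, δ₁ and 𝟏 below correspond to 1, z and e^z.

infixl 7 _⋆_
_⋆_ : (ℕ → Q5) → (ℕ → Q5) → ℕ → Q5
(f ⋆ g) n = ΣQ5 n (λ k → fromℕ (n C k) ⊗ (f k ⊗ g (n ∸ k)))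

δ₀ δ₁ : ℕ → Q5
δ₀ zero = 𝟙
δ₀ (suc _) = 𝟘
δ₁ 1 = 𝟙
δ₁ _ = 𝟘

𝟏 : ℕ → Q5
𝟏 = 𝟙 ^5_

⋆-congˡ : ∀ n {f f′ : ℕ → Q5} g → (∀ k → k ≤ n → f k ≡ f′ k) → (f ⋆ g) n ≡ (f′ ⋆ g) n
⋆-congˡ n g eq = ΣQ5-cong n (λ k k≤n → cong (λ z → fromℕ (n C k) ⊗ (z ⊗ g (n ∸ k))) (eq k k≤n))

⋆-congʳ : ∀ n (f : ℕ → Q5) {g g′} → (∀ k → k ≤ n → g k ≡ g′ k) → (f ⋆ g) n ≡ (f ⋆ g′) n
⋆-congʳ n f eq = ΣQ5-cong n (λ k _ → cong (λ z → fromℕ (n C k) ⊗ (f k ⊗ z)) (eq (n ∸ k) (N.m∸n≤m n k)))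

⋆-comm : ∀ n (f g : ℕ → Q5) → (f ⋆ g) n ≡ (g ⋆ f) n
⋆-comm n f g = trans (ΣQ5-reverse n _) (ΣQ5-cong n λ k k≤n → begin
  fromℕ (n C (n ∸ k)) ⊗ (f (n ∸ k) ⊗ g (n ∸ (n ∸ k)))  ≡⟨ cong₂ (λ c i → fromℕ c ⊗ (f (n ∸ k) ⊗ g i)) (sym (nCk≡nC[n∸k] k≤n)) (N.m∸[m∸n]≡n k≤n) ⟩
  fromℕ (n C k) ⊗ (f (n ∸ k) ⊗ g k)                    ≡⟨ cong (fromℕ (n C k) ⊗_) (⊗-comm (f (n ∸ k)) (g k)) ⟩
  fromℕ (n C k) ⊗ (g k ⊗ f (n ∸ k))                    ∎)
  where open ≡-Reasoning

⋆-⊕ˡ : ∀ n (f g h : ℕ → Q5) → ((λ k → f k ⊕ g k) ⋆ h) n ≡ (f ⋆ h) n ⊕ (g ⋆ h) n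
⋆-⊕ˡ n f g h = trans (ΣQ5-cong n (λ k _ → distrib (fromℕ (n C k)) (f k) (g k) (h (n ∸ k)))) (ΣQ5-⊕ n _ _)
  where
  distrib : ∀ c a b x → c ⊗ ((a ⊕ b) ⊗ x) ≡ (c ⊗ (a ⊗ x)) ⊕ (c ⊗ (b ⊗ x))
  distrib = solve-∀ ℚ√5

⋆-⊗ˡ : ∀ n c (f h : ℕ → Q5) → ((λ k → c ⊗ f k) ⋆ h) n ≡ c ⊗ (f ⋆ h) n
⋆-⊗ˡ n c f h = trans (ΣQ5-cong n (λ k _ → reassoc (fromℕ (n C k)) c (f k) (h (n ∸ k)))) (ΣQ5-⊗ n c _)
  where
  reassoc : ∀ b c a x → b ⊗ ((c ⊗ a) ⊗ x) ≡ c ⊗ (b ⊗ (a ⊗ x))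
  reassoc = solve-∀ ℚ√5

⋆-⊖ˡ : ∀ n (f h : ℕ → Q5) → ((λ k → ⊖ f k) ⋆ h) n ≡ ⊖ (f ⋆ h) n
⋆-⊖ˡ n f h = trans (ΣQ5-cong n (λ k _ → pull (fromℕ (n C k)) (f k) (h (n ∸ k)))) (ΣQ5-⊖ n _)
  where
  pull : ∀ b a x → b ⊗ ((⊖ a) ⊗ x) ≡ ⊖ (b ⊗ (a ⊗ x))
  pull = solve-∀ ℚ√5

⋆-⊕ʳ : ∀ n (h f g : ℕ → Q5) → (h ⋆ (λ k → f k ⊕ g k)) n ≡ (h ⋆ f) n ⊕ (h ⋆ g) n
⋆-⊕ʳ n h f g = trans (⋆-comm n h (λ k → f k ⊕ g k)) (trans (⋆-⊕ˡ n f g h) (cong₂ _⊕_ (⋆-comm n f h) (⋆-comm n g h)))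

⋆-⊗ʳ : ∀ n c (h f : ℕ → Q5) → (h ⋆ (λ k → c ⊗ f k)) n ≡ c ⊗ (h ⋆ f) n
⋆-⊗ʳ n c h f = trans (⋆-comm n h (λ k → c ⊗ f k)) (trans (⋆-⊗ˡ n c f h) (cong (c ⊗_) (⋆-comm n f h)))

⋆-⊖ʳ : ∀ n (h f : ℕ → Q5) → (h ⋆ (λ k → ⊖ f k)) n ≡ ⊖ (h ⋆ f) n
⋆-⊖ʳ n h f = trans (⋆-comm n h (λ k → ⊖ f k)) (trans (⋆-⊖ˡ n f h) (cong (λ z → ⊖ z) (⋆-comm n f h)))

⋆-identityʳ : ∀ n (f : ℕ → Q5) → (f ⋆ δ₀) n ≡ f n
⋆-identityʳ zero f = unit (f 0)
  where
  unit : ∀ x → 𝟙 ⊗ (x ⊗ 𝟙) ≡ x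
  unit = solve-∀ ℚ√5
⋆-identityʳ (suc m) f = begin
  ΣQ5 m (λ k → fromℕ (suc m C k) ⊗ (f k ⊗ δ₀ (suc m ∸ k))) ⊕ fromℕ (suc m C suc m) ⊗ (f (suc m) ⊗ δ₀ (m ∸ m))
      ≡⟨ cong₂ _⊕_ (ΣQ5-zero m (λ k k≤m → trans (cong (λ i → fromℕ (suc m C k) ⊗ (f k ⊗ δ₀ i)) (N.+-∸-assoc 1 k≤m))
                                                   (trans (cong (fromℕ (suc m C k) ⊗_) (⊗-zeroʳ (f k))) (⊗-zeroʳ (fromℕ (suc m C k))))))
                   (cong₂ (λ c i → fromℕ c ⊗ (f (suc m) ⊗ δ₀ i)) (nCn≡1 (suc m)) (N.n∸n≡0 m)) ⟩
  𝟘 ⊕ 𝟙 ⊗ (f (suc m) ⊗ 𝟙)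
      ≡⟨ unit (f (suc m)) ⟩
  f (suc m) ∎
  where
  open ≡-Reasoning
  unit : ∀ x → 𝟘 ⊕ 𝟙 ⊗ (x ⊗ 𝟙) ≡ x
  unit = solve-∀ ℚ√5

⋆-identityˡ : ∀ n (f : ℕ → Q5) → (δ₀ ⋆ f) n ≡ f n
⋆-identityˡ n f = trans (⋆-comm n δ₀ f) (⋆-identityʳ n f)

⋆-suc : ∀ n (f g : ℕ → Q5) → (f ⋆ g) (suc n) ≡ ((f ∘ suc) ⋆ g) n ⊕ (f ⋆ (g ∘ suc)) n
⋆-suc n f g = begin
  (f ⋆ g) (suc n)                                 ≡⟨ ΣQ5-unfoldˡ n (λ k → fromℕ (suc n C k) ⊗ (f k ⊗ g (suc n ∸ k))) ⟩
  head ⊕ ΣQ5 n (λ k → fromℕ (suc n C suc k) ⊗ x k) ≡⟨ cong (head ⊕_) (trans (ΣQ5-cong n (λ k _ → pascal k)) (ΣQ5-⊕ n _ _)) ⟩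
  head ⊕ (((f ∘ suc) ⋆ g) n ⊕ tail)                ≡⟨ swap head (((f ∘ suc) ⋆ g) n) tail ⟩
  ((f ∘ suc) ⋆ g) n ⊕ (head ⊕ tail)                ≡⟨ cong (((f ∘ suc) ⋆ g) n ⊕_) (sym (unfold-sucʳ n)) ⟩
  ((f ∘ suc) ⋆ g) n ⊕ (f ⋆ (g ∘ suc)) n            ∎
  where
  open ≡-Reasoning
  head tail : Q5
  head = fromℕ 1 ⊗ (f 0 ⊗ g (suc n))
  x : ℕ → Q5
  x = λ k → f (suc k) ⊗ g (n ∸ k)
  tail = ΣQ5 n (λ k → fromℕ (n C suc k) ⊗ x k)
  pascal : ∀ k → fromℕ (suc n C suc k) ⊗ x k ≡ fromℕ (n C k) ⊗ x k ⊕ fromℕ (n C suc k) ⊗ x k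
  pascal k = begin
    fromℕ (suc n C suc k) ⊗ x k                         ≡⟨ cong (λ c → fromℕ c ⊗ x k) (sym (nCk+nC[k+1]≡[n+1]C[k+1] n k)) ⟩
    fromℕ (n C k N.+ n C suc k) ⊗ x k                   ≡⟨ cong (_⊗ x k) (fromℕ-+ (n C k) (n C suc k)) ⟩
    (fromℕ (n C k) ⊕ fromℕ (n C suc k)) ⊗ x k           ≡⟨ ⊗-comm _ (x k) ⟩
    x k ⊗ (fromℕ (n C k) ⊕ fromℕ (n C suc k))           ≡⟨ ⊗-distribˡ-⊕ (x k) _ _ ⟩
    x k ⊗ fromℕ (n C k) ⊕ x k ⊗ fromℕ (n C suc k)       ≡⟨ cong₂ _⊕_ (⊗-comm (x k) _) (⊗-comm (x k) _) ⟩
    fromℕ (n C k) ⊗ x k ⊕ fromℕ (n C suc k) ⊗ x k       ∎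
  swap : ∀ a b c → a ⊕ (b ⊕ c) ≡ b ⊕ (a ⊕ c)
  swap = solve-∀ ℚ√5
  unfold-sucʳ : ∀ n → (f ⋆ (g ∘ suc)) n ≡ fromℕ 1 ⊗ (f 0 ⊗ g (suc n)) ⊕ ΣQ5 n (λ k → fromℕ (n C suc k) ⊗ (f (suc k) ⊗ g (n ∸ k)))
  unfold-sucʳ zero = sym (trans (cong (fromℕ 1 ⊗ (f 0 ⊗ g 1) ⊕_) (⊗-zeroˡ (f 1 ⊗ g 0))) (⊕-identityʳ _))
  unfold-sucʳ (suc m) = begin
    (f ⋆ (g ∘ suc)) (suc m)           ≡⟨ ΣQ5-unfoldˡ m (λ k → fromℕ (suc m C k) ⊗ (f k ⊗ g (suc (suc m ∸ k)))) ⟩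
    h₀ ⊕ ΣQ5 m lhs                      ≡⟨ cong (h₀ ⊕_) (ΣQ5-cong m (λ k k≤m → cong (λ i → fromℕ (suc m C suc k) ⊗ (f (suc k) ⊗ g i)) (sym (N.+-∸-assoc 1 k≤m)))) ⟩
    h₀ ⊕ ΣQ5 m rhs                      ≡⟨ cong (h₀ ⊕_) (sym (trans (cong (ΣQ5 m rhs ⊕_) top≡𝟘) (⊕-identityʳ _))) ⟩
    h₀ ⊕ ΣQ5 (suc m) rhs                ∎
    where
    h₀ : Q5
    h₀ = fromℕ 1 ⊗ (f 0 ⊗ g (suc (suc m)))
    lhs rhs : ℕ → Q5
    lhs k = fromℕ (suc m C suc k) ⊗ (f (suc k) ⊗ g (suc (m ∸ k)))
    rhs k = fromℕ (suc m C suc k) ⊗ (f (suc k) ⊗ g (suc m ∸ k))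
    top≡𝟘 : rhs (suc m) ≡ 𝟘
    top≡𝟘 = trans (cong (λ c → fromℕ c ⊗ (f (suc (suc m)) ⊗ g (m ∸ m))) (k>n⇒nCk≡0 (N.n<1+n (suc m)))) (⊗-zeroˡ (f (suc (suc m)) ⊗ g (m ∸ m)))

^5-⊕-⋆ : ∀ n u v (a : ℕ → Q5) → (((u ⊕ v) ^5_) ⋆ a) n ≡ ((u ^5_) ⋆ ((v ^5_) ⋆ a)) n
^5-⊕-⋆ zero u v a = units (a 0)
  where
  units : ∀ x → 𝟙 ⊗ (𝟙 ⊗ x) ≡ 𝟙 ⊗ (𝟙 ⊗ (𝟙 ⊗ (𝟙 ⊗ x)))
  units = solve-∀ ℚ√5
^5-⊕-⋆ (suc n) u v a = begin
  ((w ^5_) ⋆ a) (suc n)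
    ≡⟨ ⋆-suc n (w ^5_) a ⟩
  ((λ k → w ⊗ w ^5 k) ⋆ a) n ⊕ ((w ^5_) ⋆ (a ∘ suc)) n
    ≡⟨ cong₂ _⊕_ (trans (⋆-⊗ˡ n w (w ^5_) a) (cong (w ⊗_) (^5-⊕-⋆ n u v a))) (^5-⊕-⋆ n u v (a ∘ suc)) ⟩
  w ⊗ ((u ^5_) ⋆ A) n ⊕ ((u ^5_) ⋆ A′) n
    ≡⟨ split u v (((u ^5_) ⋆ A) n) (((u ^5_) ⋆ A′) n) ⟩
  u ⊗ ((u ^5_) ⋆ A) n ⊕ (v ⊗ ((u ^5_) ⋆ A) n ⊕ ((u ^5_) ⋆ A′) n)
    ≡⟨ cong₂ _⊕_ (sym (⋆-⊗ˡ n u (u ^5_) A)) (sym (trans (⋆-⊕ʳ n (u ^5_) (λ r → v ⊗ A r) A′) (cong (_⊕ ((u ^5_) ⋆ A′) n) (⋆-⊗ʳ n v (u ^5_) A)))) ⟩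
  ((λ k → u ⊗ u ^5 k) ⋆ A) n ⊕ ((u ^5_) ⋆ (λ r → v ⊗ A r ⊕ A′ r)) n
    ≡⟨ cong (((λ k → u ⊗ u ^5 k) ⋆ A) n ⊕_) (⋆-congʳ n (u ^5_) (λ r _ → sym (A-suc r))) ⟩
  ((λ k → u ⊗ u ^5 k) ⋆ A) n ⊕ ((u ^5_) ⋆ (A ∘ suc)) n
    ≡⟨ sym (⋆-suc n (u ^5_) A) ⟩
  ((u ^5_) ⋆ A) (suc n) ∎
  where
  open ≡-Reasoning
  w : Q5
  w = u ⊕ v
  A A′ : ℕ → Q5
  A = (v ^5_) ⋆ a
  A′ = (v ^5_) ⋆ (a ∘ suc)
  A-suc : ∀ r → A (suc r) ≡ v ⊗ A r ⊕ A′ r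
  A-suc r = trans (⋆-suc r (v ^5_) a) (cong (_⊕ A′ r) (⋆-⊗ˡ r v (v ^5_) a))
  split : ∀ u v x y → (u ⊕ v) ⊗ x ⊕ y ≡ u ⊗ x ⊕ (v ⊗ x ⊕ y)
  split = solve-∀ ℚ√5

binomial : ∀ n u v → (u ⊕ v) ^5 n ≡ ((u ^5_) ⋆ (v ^5_)) n
binomial n u v = begin
  (u ⊕ v) ^5 n                            ≡⟨ sym (⋆-identityʳ n ((u ⊕ v) ^5_)) ⟩
  (((u ⊕ v) ^5_) ⋆ δ₀) n                   ≡⟨ ^5-⊕-⋆ n u v δ₀ ⟩
  ((u ^5_) ⋆ ((v ^5_) ⋆ δ₀)) n             ≡⟨ ⋆-congʳ n (u ^5_) (λ r _ → ⋆-identityʳ r (v ^5_)) ⟩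
  ((u ^5_) ⋆ (v ^5_)) n                    ∎
  where open ≡-Reasoning

^5-⋆-^5-⊗ : ∀ r v (w : ℕ → Q5) → ((v ^5_) ⋆ (λ i → v ^5 i ⊗ w i)) r ≡ v ^5 r ⊗ (w ⋆ 𝟏) r
^5-⋆-^5-⊗ r v w = begin
  ((v ^5_) ⋆ (λ i → v ^5 i ⊗ w i)) r
    ≡⟨ ΣQ5-cong r (λ k k≤r → trans (regroup (fromℕ (r C k)) (v ^5 k) (v ^5 (r ∸ k)) (w (r ∸ k)))
                                    (cong₂ (λ x y → x ⊗ (fromℕ (r C k) ⊗ (y ⊗ w (r ∸ k)))) (v^k⊗v^[r∸k] k≤r) (sym (𝟙^5 k)))) ⟩
  ΣQ5 r (λ k → v ^5 r ⊗ (fromℕ (r C k) ⊗ (𝟏 k ⊗ w (r ∸ k))))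
    ≡⟨ ΣQ5-⊗ r (v ^5 r) _ ⟩
  v ^5 r ⊗ (𝟏 ⋆ w) r
    ≡⟨ cong (v ^5 r ⊗_) (⋆-comm r 𝟏 w) ⟩
  v ^5 r ⊗ (w ⋆ 𝟏) r ∎
  where
  open ≡-Reasoning
  regroup : ∀ c x y z → c ⊗ (x ⊗ (y ⊗ z)) ≡ (x ⊗ y) ⊗ (c ⊗ (𝟙 ⊗ z))
  regroup = solve-∀ ℚ√5
  v^k⊗v^[r∸k] : ∀ {k} → k ≤ r → v ^5 k ⊗ v ^5 (r ∸ k) ≡ v ^5 r
  v^k⊗v^[r∸k] {k} k≤r = trans (sym (^5-+ v k (r ∸ k))) (cong (v ^5_) (N.m+[n∸m]≡n k≤r))

⋆-transfer : ∀ n u v (w : ℕ → Q5) → (((u ⊕ v) ^5_) ⋆ (λ i → v ^5 i ⊗ w i)) n ≡ ((u ^5_) ⋆ (λ r → v ^5 r ⊗ (w ⋆ 𝟏) r)) n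
⋆-transfer n u v w = trans (^5-⊕-⋆ n u v (λ i → v ^5 i ⊗ w i)) (⋆-congʳ n (u ^5_) (λ r _ → ^5-⋆-^5-⊗ r v w))

ΣQ5-last : ∀ n {f : ℕ → Q5} → (∀ k → k < n → f k ≡ 𝟘) → ΣQ5 n f ≡ f n
ΣQ5-last zero _ = refl
ΣQ5-last (suc n) {f} below = trans (cong (_⊕ f (suc n)) (ΣQ5-zero n (λ k k≤n → below k (s≤s k≤n)))) (⊕-identityˡ (f (suc n)))

⋆𝟏-fixed⇒𝟘 : ∀ (h : ℕ → Q5) → (∀ n → (h ⋆ 𝟏) n ≡ h n) → ∀ n → h n ≡ 𝟘
⋆𝟏-fixed⇒𝟘 h fixed n = vanishes-below (suc n) n N.≤-refl
  where
  top-two : ∀ m → (∀ k → k < m → h k ≡ 𝟘) → (h ⋆ 𝟏) (suc m) ≡ fromℕ (suc m) ⊗ h m ⊕ h (suc m)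
  top-two m below = cong₂ _⊕_ penultimate last
    where
    zero-term : ∀ c y → c ⊗ (𝟘 ⊗ y) ≡ 𝟘
    zero-term = solve-∀ ℚ√5
    unit₁ : ∀ c x → c ⊗ (x ⊗ (𝟙 ⊗ 𝟙)) ≡ c ⊗ x
    unit₁ = solve-∀ ℚ√5
    unit₀ : ∀ x → 𝟙 ⊗ (x ⊗ 𝟙) ≡ x
    unit₀ = solve-∀ ℚ√5
    penultimate : ΣQ5 m (λ k → fromℕ (suc m C k) ⊗ (h k ⊗ 𝟏 (suc m ∸ k))) ≡ fromℕ (suc m) ⊗ h m
    penultimate = begin
      ΣQ5 m (λ k → fromℕ (suc m C k) ⊗ (h k ⊗ 𝟏 (suc m ∸ k)))
        ≡⟨ ΣQ5-last m (λ k k<m → trans (cong (λ x → fromℕ (suc m C k) ⊗ (x ⊗ 𝟏 (suc m ∸ k))) (below k k<m)) (zero-term (fromℕ (suc m C k)) (𝟏 (suc m ∸ k)))) ⟩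
      fromℕ (suc m C m) ⊗ (h m ⊗ 𝟏 (suc m ∸ m))
        ≡⟨ cong₂ (λ c x → fromℕ c ⊗ (h m ⊗ 𝟏 x)) ([1+n]Cn≡1+n m) (N.m+n∸n≡m 1 m) ⟩
      fromℕ (suc m) ⊗ (h m ⊗ (𝟙 ⊗ 𝟙))
        ≡⟨ unit₁ (fromℕ (suc m)) (h m) ⟩
      fromℕ (suc m) ⊗ h m ∎
      where open ≡-Reasoning
    last : fromℕ (suc m C suc m) ⊗ (h (suc m) ⊗ 𝟏 (m ∸ m)) ≡ h (suc m)
    last = trans (cong₂ (λ c x → fromℕ c ⊗ (h (suc m) ⊗ 𝟏 x)) (nCn≡1 (suc m)) (N.n∸n≡0 m)) (unit₀ (h (suc m)))
  step : ∀ m → (∀ k → k < m → h k ≡ 𝟘) → h m ≡ 𝟘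
  step m below = fromℕ-cancelˡ (suc m) (λ ()) (trans (cancel (fromℕ (suc m) ⊗ h m) (h (suc m)) (trans (sym (top-two m below)) (fixed (suc m)))) (sym (⊗-zeroʳ (fromℕ (suc m)))))
    where
    cancel : ∀ a b → a ⊕ b ≡ b → a ≡ 𝟘
    cancel a b a+b≡b = trans (sym (+-cancel a b)) (trans (cong (_⊕ (⊖ b)) a+b≡b) (⊕-inverseʳ b))
      where
      +-cancel : ∀ a b → (a ⊕ b) ⊕ (⊖ b) ≡ a
      +-cancel = solve-∀ ℚ√5
      ⊕-inverseʳ : ∀ b → b ⊕ (⊖ b) ≡ 𝟘
      ⊕-inverseʳ = solve-∀ ℚ√5
  vanishes-below : ∀ n k → k < n → h k ≡ 𝟘
  vanishes-below (suc n) k k<1+n with N.m<1+n⇒m<n∨m≡n k<1+n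
  ... | inj₁ k<n  = vanishes-below n k k<n
  ... | inj₂ refl = step k (vanishes-below k)

pronic : ℕ → ℕ
pronic r = suc r N.* suc (suc r)

C-absorb₂ : ∀ n r → (suc (suc n) C suc (suc r)) N.* pronic r ≡ pronic n N.* (n C r)
C-absorb₂ n r = begin
  c₂ N.* (suc r N.* suc (suc r))           ≡⟨ rearrange₁ c₂ r ⟩
  suc r N.* (suc (suc r) N.* c₂)           ≡⟨ cong (suc r N.*_) (C-absorb (suc n) (suc r)) ⟩
  suc r N.* (suc (suc n) N.* c₁)           ≡⟨ rearrange₂ r n c₁ ⟩
  suc (suc n) N.* (suc r N.* c₁)           ≡⟨ cong (suc (suc n) N.*_) (C-absorb n r) ⟩
  suc (suc n) N.* (suc n N.* (n C r))      ≡⟨ rearrange₃ n (n C r) ⟩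
  pronic n N.* (n C r)                     ∎
  where
  open ≡-Reasoning
  c₂ c₁ : ℕ
  c₂ = suc (suc n) C suc (suc r)
  c₁ = suc n C suc r
  rearrange₁ : ∀ c r → c N.* (suc r N.* suc (suc r)) ≡ suc r N.* (suc (suc r) N.* c)
  rearrange₁ = ℕ-solve-∀
  rearrange₂ : ∀ r n c → suc r N.* (suc (suc n) N.* c) ≡ suc (suc n) N.* (suc r N.* c)
  rearrange₂ = ℕ-solve-∀
  rearrange₃ : ∀ n c → suc (suc n) N.* (suc n N.* c) ≡ (suc n N.* suc (suc n)) N.* c
  rearrange₃ = ℕ-solve-∀

⋆-unfold-top₂ : ∀ n (f A : ℕ → Q5) →
  (f ⋆ A) (suc (suc n)) ≡ fromℕ (pronic n) ⊗ (f ⋆ (λ r → 1/ pronic r ⊗ A (suc (suc r)))) n ⊕ fromℕ (suc (suc n)) ⊗ (f (suc n) ⊗ A 1) ⊕ f (suc (suc n)) ⊗ A 0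
⋆-unfold-top₂ n f A = cong₂ _⊕_ (cong₂ _⊕_ low middle) top
  where
  regroup : ∀ p c i x a → (p ⊗ c ⊗ i) ⊗ (x ⊗ a) ≡ p ⊗ (c ⊗ (x ⊗ (i ⊗ a)))
  regroup = solve-∀ ℚ√5
  coefficient : ∀ m → m ≤ n → fromℕ (suc (suc n) C m) ≡ fromℕ (pronic n) ⊗ fromℕ (n C m) ⊗ 1/ pronic (n ∸ m)
  coefficient m m≤n = trans (fromℕ-quotient (suc (suc n) C m) (pronic (n ∸ m)) (λ ()) (begin
      (suc (suc n) C m) N.* pronic (n ∸ m)                     ≡⟨ cong (N._* pronic (n ∸ m)) (trans (nCk≡nC[n∸k] (N.m≤n⇒m≤o+n 2 m≤n)) (cong (suc (suc n) C_) (N.+-∸-assoc 2 m≤n))) ⟩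
      (suc (suc n) C suc (suc (n ∸ m))) N.* pronic (n ∸ m)     ≡⟨ C-absorb₂ n (n ∸ m) ⟩
      pronic n N.* (n C (n ∸ m))                               ≡⟨ cong (pronic n N.*_) (sym (nCk≡nC[n∸k] m≤n)) ⟩
      pronic n N.* (n C m)                                     ∎))
    (cong (_⊗ 1/ pronic (n ∸ m)) (fromℕ-* (pronic n) (n C m)))
    where open ≡-Reasoning
  low : ΣQ5 n (λ m → fromℕ (suc (suc n) C m) ⊗ (f m ⊗ A (suc (suc n) ∸ m))) ≡ fromℕ (pronic n) ⊗ (f ⋆ (λ r → 1/ pronic r ⊗ A (suc (suc r)))) n
  low = trans (ΣQ5-cong n (λ m m≤n → trans (cong₂ (λ c i → c ⊗ (f m ⊗ A i)) (coefficient m m≤n) (N.+-∸-assoc 2 m≤n))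
                                            (regroup (fromℕ (pronic n)) (fromℕ (n C m)) (1/ pronic (n ∸ m)) (f m) (A (suc (suc (n ∸ m)))))))
              (ΣQ5-⊗ n (fromℕ (pronic n)) (λ m → fromℕ (n C m) ⊗ (f m ⊗ (1/ pronic (n ∸ m) ⊗ A (suc (suc (n ∸ m)))))))
  middle : fromℕ (suc (suc n) C suc n) ⊗ (f (suc n) ⊗ A (suc n ∸ n)) ≡ fromℕ (suc (suc n)) ⊗ (f (suc n) ⊗ A 1)
  middle = cong₂ (λ c i → fromℕ c ⊗ (f (suc n) ⊗ A i)) ([1+n]Cn≡1+n (suc n)) (N.m+n∸n≡m 1 n)
  top : fromℕ (suc (suc n) C suc (suc n)) ⊗ (f (suc (suc n)) ⊗ A (n ∸ n)) ≡ f (suc (suc n)) ⊗ A 0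
  top = trans (cong₂ (λ c i → fromℕ c ⊗ (f (suc (suc n)) ⊗ A i)) (nCn≡1 (suc (suc n))) (N.n∸n≡0 n)) (⊗-identityˡ (f (suc (suc n)) ⊗ A 0))

𝔹 : ℕ → Q5
𝔹 k = ⟦ B k ⟧

bt-stable : ∀ m k → k ≤ m → bt m k ≡ B k
bt-stable zero zero _ = refl
bt-stable (suc m) k k≤1+m with N.m≤n⇒m<n∨m≡n k≤1+m
... | inj₂ refl = refl
... | inj₁ (s≤s k≤m) with k N.≤ᵇ m | N.≤⇒≤ᵇ k≤m
...   | true | _ = bt-stable m k k≤m

𝔹-recurrence : ∀ m → fromℕ (suc (suc m)) ⊗ 𝔹 (suc m) ⊕ ΣQ5 m (λ i → fromℕ (suc (suc m) C i) ⊗ 𝔹 i) ≡ 𝟘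
𝔹-recurrence m = begin
  n ⊗ 𝔹 (suc m) ⊕ Σ                                       ≡⟨ cong (λ b → n ⊗ ⟦ b ⟧ ⊕ Σ) (last-entry (suc m N.≤ᵇ m) 1+m≰ᵇm) ⟩
  n ⊗ ⟦ - ((1ℚ /' ι (suc (suc m))) * Σ≤ m term) ⟧ ⊕ Σ      ≡⟨ cong (λ x → n ⊗ (⊖ x) ⊕ Σ) (trans (⟦⟧-* (1ℚ /' ι (suc (suc m))) (Σ≤ m term)) (cong (1/ suc (suc m) ⊗_) embed-sum)) ⟩
  n ⊗ (⊖ (1/ suc (suc m) ⊗ Σ)) ⊕ Σ                        ≡⟨ cancel n (1/ suc (suc m)) Σ ⟩
  ⊖ ((1/ suc (suc m) ⊗ n) ⊗ Σ) ⊕ Σ                        ≡⟨ cong (λ x → ⊖ (x ⊗ Σ) ⊕ Σ) (1/-inverseˡ (suc (suc m)) (λ ())) ⟩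
  ⊖ (𝟙 ⊗ Σ) ⊕ Σ                                           ≡⟨ vanish Σ ⟩
  𝟘                                                       ∎
  where
  open ≡-Reasoning
  n Σ : Q5
  n = fromℕ (suc (suc m))
  Σ = ΣQ5 m (λ i → fromℕ (suc (suc m) C i) ⊗ 𝔹 i)
  term : ℕ → ℚ
  term = λ i → ι (suc (suc m) C i) * bt m i
  1+m≰ᵇm : (suc m N.≤ᵇ m) ≡ false
  1+m≰ᵇm with suc m N.≤ᵇ m | N.≤ᵇ⇒≤ (suc m) m
  ... | false | _ = refl
  ... | true  | 1+m≤m = ⊥-elim (N.<-irrefl refl (1+m≤m tt))
  last-entry : ∀ b → b ≡ false → (if b then bt m (suc m) else - ((1ℚ /' ι (suc (suc m))) * Σ≤ m term)) ≡ - ((1ℚ /' ι (suc (suc m))) * Σ≤ m term)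
  last-entry b refl = refl
  embed-sum : ⟦ Σ≤ m term ⟧ ≡ Σ
  embed-sum = trans (embed m) (ΣQ5-cong m (λ i i≤m → trans (⟦⟧-* (ι (suc (suc m) C i)) (bt m i)) (cong (λ b → fromℕ (suc (suc m) C i) ⊗ ⟦ b ⟧) (bt-stable m i i≤m))))
    where
    embed : ∀ k → ⟦ Σ≤ k term ⟧ ≡ ΣQ5 k (λ i → ⟦ term i ⟧)
    embed zero = refl
    embed (suc k) = cong (_⊕ ⟦ term (suc k) ⟧) (embed k)
  cancel : ∀ n i s → n ⊗ (⊖ (i ⊗ s)) ⊕ s ≡ ⊖ ((i ⊗ n) ⊗ s) ⊕ s
  cancel = solve-∀ ℚ√5
  vanish : ∀ s → ⊖ (𝟙 ⊗ s) ⊕ s ≡ 𝟘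
  vanish = solve-∀ ℚ√5

⋆𝟏-unfold : ∀ n (f : ℕ → Q5) → (f ⋆ 𝟏) n ≡ ΣQ5 n (λ k → fromℕ (n C k) ⊗ f k)
⋆𝟏-unfold n f = ΣQ5-cong n (λ k _ → cong (fromℕ (n C k) ⊗_) (trans (cong (f k ⊗_) (𝟙^5 (n ∸ k))) (⊗-identityʳ (f k))))

𝔹⋆𝟏 : ∀ n → (𝔹 ⋆ 𝟏) n ≡ 𝔹 n ⊕ δ₁ n
𝔹⋆𝟏 zero = refl
𝔹⋆𝟏 (suc zero) = refl
𝔹⋆𝟏 (suc (suc m)) = begin
  (𝔹 ⋆ 𝟏) (suc (suc m))
    ≡⟨ ⋆𝟏-unfold (suc (suc m)) 𝔹 ⟩
  ΣQ5 m t ⊕ fromℕ (suc (suc m) C suc m) ⊗ 𝔹 (suc m) ⊕ fromℕ (suc (suc m) C suc (suc m)) ⊗ 𝔹 (suc (suc m))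
    ≡⟨ cong₂ (λ c d → ΣQ5 m t ⊕ fromℕ c ⊗ 𝔹 (suc m) ⊕ fromℕ d ⊗ 𝔹 (suc (suc m))) ([1+n]Cn≡1+n (suc m)) (nCn≡1 (suc (suc m))) ⟩
  ΣQ5 m t ⊕ fromℕ (suc (suc m)) ⊗ 𝔹 (suc m) ⊕ 𝟙 ⊗ 𝔹 (suc (suc m))
    ≡⟨ cong (_⊕ 𝟙 ⊗ 𝔹 (suc (suc m))) (trans (⊕-comm (ΣQ5 m t) _) (𝔹-recurrence m)) ⟩
  𝟘 ⊕ 𝟙 ⊗ 𝔹 (suc (suc m))
    ≡⟨ unit (𝔹 (suc (suc m))) ⟩
  𝔹 (suc (suc m)) ⊕ 𝟘 ∎
  where
  open ≡-Reasoning
  t : ℕ → Q5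
  t = λ i → fromℕ (suc (suc m) C i) ⊗ 𝔹 i
  unit : ∀ x → 𝟘 ⊕ 𝟙 ⊗ x ≡ x ⊕ 𝟘
  unit = solve-∀ ℚ√5

isEven-suc-suc : ∀ m → isEven (suc (suc m)) ≡ isEven m
isEven-suc-suc m with isEven m
... | true  = refl
... | false = refl

even⇒suc-odd : ∀ m → isEven m ≡ true → isEven (suc m) ≡ false
even⇒suc-odd m m-even = cong (λ b → if b then false else true) m-even

odd⇒suc-even : ∀ m → isEven m ≡ false → isEven (suc m) ≡ true
odd⇒suc-even m m-odd = cong (λ b → if b then false else true) m-odd

σ : ℕ → Q5
σ = (⊖ 𝟙) ^5_

σ-parity : ∀ k → σ k ≡ (if isEven k then 𝟙 else ⊖ 𝟙)
σ-parity zero = refl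
σ-parity (suc k) with isEven k | σ-parity k
... | true  | σk≡𝟙  = trans (cong ((⊖ 𝟙) ⊗_) σk≡𝟙) (⊗-identityʳ (⊖ 𝟙))
... | false | σk≡-𝟙 = cong ((⊖ 𝟙) ⊗_) σk≡-𝟙

σ-even : ∀ k → isEven k ≡ true → σ k ≡ 𝟙
σ-even k k-even = trans (σ-parity k) (cong (λ b → if b then 𝟙 else ⊖ 𝟙) k-even)

σ-odd : ∀ k → isEven k ≡ false → σ k ≡ ⊖ 𝟙
σ-odd k k-odd = trans (σ-parity k) (cong (λ b → if b then 𝟙 else ⊖ 𝟙) k-odd)

σ⊗σ : ∀ k → σ k ⊗ σ k ≡ 𝟙
σ⊗σ k = trans (sym (⊗-^5 (⊖ 𝟙) (⊖ 𝟙) k)) (𝟙^5 k)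

⊖-^5 : ∀ x k → (⊖ x) ^5 k ≡ σ k ⊗ x ^5 k
⊖-^5 x k = trans (cong (_^5 k) (⊖≡-𝟙⊗ x)) (⊗-^5 (⊖ 𝟙) x k)
  where
  ⊖≡-𝟙⊗ : ∀ x → ⊖ x ≡ (⊖ 𝟙) ⊗ x
  ⊖≡-𝟙⊗ = solve-∀ ℚ√5

⋆-σ : ∀ n (f g : ℕ → Q5) → ((λ k → σ k ⊗ f k) ⋆ (λ k → σ k ⊗ g k)) n ≡ σ n ⊗ (f ⋆ g) n
⋆-σ n f g = trans (ΣQ5-cong n (λ k k≤n → trans (regroup (fromℕ (n C k)) (σ k) (σ (n ∸ k)) (f k) (g (n ∸ k))) (cong (_⊗ (fromℕ (n C k) ⊗ (f k ⊗ g (n ∸ k)))) (σ-split k≤n))))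
                  (ΣQ5-⊗ n (σ n) (λ k → fromℕ (n C k) ⊗ (f k ⊗ g (n ∸ k))))
  where
  regroup : ∀ c s t a b → c ⊗ ((s ⊗ a) ⊗ (t ⊗ b)) ≡ (s ⊗ t) ⊗ (c ⊗ (a ⊗ b))
  regroup = solve-∀ ℚ√5
  σ-split : ∀ {k} → k ≤ n → σ k ⊗ σ (n ∸ k) ≡ σ n
  σ-split {k} k≤n = trans (sym (^5-+ (⊖ 𝟙) k (n ∸ k))) (cong σ (N.m+[n∸m]≡n k≤n))

σ⊗δ₁ : ∀ k → σ k ⊗ δ₁ k ≡ ⊖ δ₁ k
σ⊗δ₁ zero = refl
σ⊗δ₁ (suc zero) = refl
σ⊗δ₁ (suc (suc k)) = ⊗-zeroʳ (σ (suc (suc k)))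

-- B(−z) = B(z) + z for B(z) = z/(e^z − 1).
σ⊗𝔹 : ∀ n → σ n ⊗ 𝔹 n ≡ 𝔹 n ⊕ δ₁ n
σ⊗𝔹 n = begin
  σ n ⊗ 𝔹 n                        ≡⟨ split (σ n) (𝔹 n) (δ₁ n) ⟩
  (σ n ⊗ β n) ⊖ (σ n ⊗ δ₁ n)       ≡⟨ cong₂ _⊖_ (⊖≡𝟘⇒≡ (σβ n) (𝔹 n) (⋆𝟏-fixed⇒𝟘 H H-fixed n)) (σ⊗δ₁ n) ⟩
  𝔹 n ⊖ (⊖ δ₁ n)                   ≡⟨ double-negation (𝔹 n) (δ₁ n) ⟩
  𝔹 n ⊕ δ₁ n                       ∎
  where
  open ≡-Reasoning
  split : ∀ s b d → s ⊗ b ≡ (s ⊗ (b ⊕ d)) ⊖ (s ⊗ d)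
  split = solve-∀ ℚ√5
  double-negation : ∀ b d → b ⊖ (⊖ d) ≡ b ⊕ d
  double-negation = solve-∀ ℚ√5
  β σβ H : ℕ → Q5
  β k = 𝔹 k ⊕ δ₁ k
  σβ k = σ k ⊗ β k
  H k = σβ k ⊖ 𝔹 k
  𝔹≡σ⋆β : ∀ n → 𝔹 n ≡ (σ ⋆ β) n
  𝔹≡σ⋆β n = begin
    𝔹 n                                ≡⟨ sym (⋆-identityˡ n 𝔹) ⟩
    (δ₀ ⋆ 𝔹) n                         ≡⟨ ⋆-congˡ n 𝔹 (λ k _ → sym (𝟘^5 k)) ⟩
    ((𝟘 ^5_) ⋆ 𝔹) n                    ≡⟨ cong (λ z → ((z ^5_) ⋆ 𝔹) n) (sym (⊕-inverseˡ 𝟙)) ⟩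
    ((((⊖ 𝟙) ⊕ 𝟙) ^5_) ⋆ 𝔹) n          ≡⟨ ^5-⊕-⋆ n (⊖ 𝟙) 𝟙 𝔹 ⟩
    (σ ⋆ (𝟏 ⋆ 𝔹)) n                    ≡⟨ ⋆-congʳ n σ (λ r _ → trans (⋆-comm r 𝟏 𝔹) (𝔹⋆𝟏 r)) ⟩
    (σ ⋆ β) n                          ∎
    where
    𝟘^5 : ∀ k → 𝟘 ^5 k ≡ δ₀ k
    𝟘^5 zero = refl
    𝟘^5 (suc k) = ⊗-zeroˡ (𝟘 ^5 k)
  σ⊗𝔹≡σβ⋆𝟏 : ∀ n → σ n ⊗ 𝔹 n ≡ (σβ ⋆ 𝟏) n
  σ⊗𝔹≡σβ⋆𝟏 n = begin
    σ n ⊗ 𝔹 n                                                   ≡⟨ cong (σ n ⊗_) (𝔹≡σ⋆β n) ⟩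
    σ n ⊗ (σ ⋆ β) n                                             ≡⟨ cong (σ n ⊗_) (trans (⋆-congˡ n β (λ k _ → sym (σ⊗𝟏 k))) (⋆-congʳ n (λ k → σ k ⊗ 𝟏 k) (λ k _ → sym (σ⊗σβ k)))) ⟩
    σ n ⊗ ((λ k → σ k ⊗ 𝟏 k) ⋆ (λ k → σ k ⊗ σβ k)) n             ≡⟨ cong (σ n ⊗_) (⋆-σ n 𝟏 σβ) ⟩
    σ n ⊗ (σ n ⊗ (𝟏 ⋆ σβ) n)                                    ≡⟨ sym (⊗-assoc (σ n) (σ n) ((𝟏 ⋆ σβ) n)) ⟩
    (σ n ⊗ σ n) ⊗ (𝟏 ⋆ σβ) n                                    ≡⟨ cong (_⊗ (𝟏 ⋆ σβ) n) (σ⊗σ n) ⟩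
    𝟙 ⊗ (𝟏 ⋆ σβ) n                                              ≡⟨ ⊗-identityˡ ((𝟏 ⋆ σβ) n) ⟩
    (𝟏 ⋆ σβ) n                                                  ≡⟨ ⋆-comm n 𝟏 σβ ⟩
    (σβ ⋆ 𝟏) n                                                  ∎
    where
    σ⊗𝟏 : ∀ k → σ k ⊗ 𝟏 k ≡ σ k
    σ⊗𝟏 k = trans (cong (σ k ⊗_) (𝟙^5 k)) (⊗-identityʳ (σ k))
    σ⊗σβ : ∀ k → σ k ⊗ σβ k ≡ β k
    σ⊗σβ k = trans (sym (⊗-assoc (σ k) (σ k) (β k))) (trans (cong (_⊗ β k) (σ⊗σ k)) (⊗-identityˡ (β k)))
  H-fixed : ∀ n → (H ⋆ 𝟏) n ≡ H n
  H-fixed n = begin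
    (H ⋆ 𝟏) n                               ≡⟨ trans (⋆-⊕ˡ n σβ (λ k → ⊖ 𝔹 k) 𝟏) (cong ((σβ ⋆ 𝟏) n ⊕_) (⋆-⊖ˡ n 𝔹 𝟏)) ⟩
    (σβ ⋆ 𝟏) n ⊖ (𝔹 ⋆ 𝟏) n                  ≡⟨ cong₂ _⊖_ (sym (σ⊗𝔹≡σβ⋆𝟏 n)) (𝔹⋆𝟏 n) ⟩
    (σ n ⊗ 𝔹 n) ⊖ (𝔹 n ⊕ δ₁ n)              ≡⟨ cong (λ x → (σ n ⊗ 𝔹 n) ⊖ (𝔹 n ⊕ x)) (sym (trans (cong (λ y → ⊖ y) (σ⊗δ₁ n)) (⊖-involutive (δ₁ n)))) ⟩
    (σ n ⊗ 𝔹 n) ⊖ (𝔹 n ⊕ ⊖ (σ n ⊗ δ₁ n))    ≡⟨ regroup (σ n) (𝔹 n) (δ₁ n) ⟩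
    H n                                     ∎
    where
    ⊖-involutive : ∀ x → ⊖ (⊖ x) ≡ x
    ⊖-involutive = solve-∀ ℚ√5
    regroup : ∀ s b d → (s ⊗ b) ⊖ (b ⊕ ⊖ (s ⊗ d)) ≡ (s ⊗ (b ⊕ d)) ⊖ b
    regroup = solve-∀ ℚ√5

𝔹-odd : ∀ m → isEven m ≡ false → 𝔹 (suc (suc m)) ≡ 𝟘
𝔹-odd m m-odd = fromℕ-cancelˡ 2 (λ ()) (begin
  fromℕ 2 ⊗ b                     ≡⟨ twice b ⟩
  b ⊕ b                           ≡⟨ cong (b ⊕_) (sym (trans (⊕-comm b 𝟘) (⊕-identityˡ b))) ⟩
  b ⊕ (b ⊕ 𝟘)                     ≡⟨ cong (b ⊕_) (sym (σ⊗𝔹 (suc (suc m)))) ⟩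
  b ⊕ σ (suc (suc m)) ⊗ b         ≡⟨ cong (λ s → b ⊕ s ⊗ b) (σ-odd (suc (suc m)) (trans (isEven-suc-suc m) m-odd)) ⟩
  b ⊕ (⊖ 𝟙) ⊗ b                   ≡⟨ cancel b ⟩
  𝟘                               ≡⟨ sym (⊗-zeroʳ (fromℕ 2)) ⟩
  fromℕ 2 ⊗ 𝟘                     ∎)
  where
  open ≡-Reasoning
  b : Q5
  b = 𝔹 (suc (suc m))
  twice : ∀ x → fromℕ 2 ⊗ x ≡ x ⊕ x
  twice = solve-∀ ℚ√5
  cancel : ∀ x → x ⊕ (⊖ 𝟙) ⊗ x ≡ 𝟘
  cancel = solve-∀ ℚ√5

𝔹₂ : ℕ → Q5
𝔹₂ k = fromℕ 2 ^5 k ⊗ 𝔹 k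

⋆𝟏-⋆𝟏 : ∀ n (f : ℕ → Q5) → ((f ⋆ 𝟏) ⋆ 𝟏) n ≡ ((fromℕ 2 ^5_) ⋆ f) n
⋆𝟏-⋆𝟏 n f = begin
  ((f ⋆ 𝟏) ⋆ 𝟏) n               ≡⟨ ⋆-comm n (f ⋆ 𝟏) 𝟏 ⟩
  (𝟏 ⋆ (f ⋆ 𝟏)) n               ≡⟨ ⋆-congʳ n 𝟏 (λ r _ → ⋆-comm r f 𝟏) ⟩
  (𝟏 ⋆ (𝟏 ⋆ f)) n               ≡⟨ sym (^5-⊕-⋆ n 𝟙 𝟙 f) ⟩
  ((fromℕ 2 ^5_) ⋆ f) n         ∎
  where open ≡-Reasoning

-- Σ_k C(n,k) 2^k B_k = 2^n B_n(1/2), and B_n(1/2) = (2^{1−n} − 1) B_n.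
𝔹-duplication : ∀ n → (𝔹₂ ⋆ 𝟏) n ≡ (fromℕ 2 ⊗ 𝔹 n) ⊖ 𝔹₂ n
𝔹-duplication n = ⊖≡𝟘⇒≡ _ _ (trans (regroup ((𝔹₂ ⋆ 𝟏) n) (𝔹₂ n) (fromℕ 2 ⊗ 𝔹 n)) (⋆𝟏-fixed⇒𝟘 G G-fixed n))
  where
  regroup : ∀ s b t → s ⊖ (t ⊖ b) ≡ (s ⊕ b) ⊖ t
  regroup = solve-∀ ℚ√5
  G : ℕ → Q5
  G k = ((𝔹₂ ⋆ 𝟏) k ⊕ 𝔹₂ k) ⊖ (fromℕ 2 ⊗ 𝔹 k)
  2^⊗δ₁ : ∀ k → fromℕ 2 ^5 k ⊗ δ₁ k ≡ fromℕ 2 ⊗ δ₁ k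
  2^⊗δ₁ zero = refl
  2^⊗δ₁ (suc zero) = refl
  2^⊗δ₁ (suc (suc k)) = trans (⊗-zeroʳ (fromℕ 2 ^5 suc (suc k))) (sym (⊗-zeroʳ (fromℕ 2)))
  G-fixed : ∀ n → (G ⋆ 𝟏) n ≡ G n
  G-fixed n = begin
    (G ⋆ 𝟏) n
      ≡⟨ trans (⋆-⊕ˡ n (λ k → (𝔹₂ ⋆ 𝟏) k ⊕ 𝔹₂ k) (λ k → ⊖ (fromℕ 2 ⊗ 𝔹 k)) 𝟏)
               (cong₂ _⊕_ (⋆-⊕ˡ n (𝔹₂ ⋆ 𝟏) 𝔹₂ 𝟏) (trans (⋆-⊖ˡ n (λ k → fromℕ 2 ⊗ 𝔹 k) 𝟏) (cong (λ x → ⊖ x) (⋆-⊗ˡ n (fromℕ 2) 𝔹 𝟏)))) ⟩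
    (((𝔹₂ ⋆ 𝟏) ⋆ 𝟏) n ⊕ (𝔹₂ ⋆ 𝟏) n) ⊖ (fromℕ 2 ⊗ (𝔹 ⋆ 𝟏) n)
      ≡⟨ cong (λ x → (x ⊕ (𝔹₂ ⋆ 𝟏) n) ⊖ (fromℕ 2 ⊗ (𝔹 ⋆ 𝟏) n)) (trans (⋆𝟏-⋆𝟏 n 𝔹₂) (^5-⋆-^5-⊗ n (fromℕ 2) 𝔹)) ⟩
    ((fromℕ 2 ^5 n ⊗ (𝔹 ⋆ 𝟏) n ⊕ (𝔹₂ ⋆ 𝟏) n)) ⊖ (fromℕ 2 ⊗ (𝔹 ⋆ 𝟏) n)
      ≡⟨ cong (λ x → (fromℕ 2 ^5 n ⊗ x ⊕ (𝔹₂ ⋆ 𝟏) n) ⊖ (fromℕ 2 ⊗ x)) (𝔹⋆𝟏 n) ⟩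
    ((fromℕ 2 ^5 n ⊗ (𝔹 n ⊕ δ₁ n) ⊕ (𝔹₂ ⋆ 𝟏) n)) ⊖ (fromℕ 2 ⊗ (𝔹 n ⊕ δ₁ n))
      ≡⟨ expand (fromℕ 2 ^5 n) (fromℕ 2) (𝔹 n) (δ₁ n) ((𝔹₂ ⋆ 𝟏) n) ⟩
    ((fromℕ 2 ^5 n ⊗ 𝔹 n ⊕ ((fromℕ 2 ^5 n ⊗ δ₁ n) ⊖ (fromℕ 2 ⊗ δ₁ n)) ⊕ (𝔹₂ ⋆ 𝟏) n)) ⊖ (fromℕ 2 ⊗ 𝔹 n)
      ≡⟨ cong (λ x → ((fromℕ 2 ^5 n ⊗ 𝔹 n ⊕ (x ⊖ (fromℕ 2 ⊗ δ₁ n)) ⊕ (𝔹₂ ⋆ 𝟏) n)) ⊖ (fromℕ 2 ⊗ 𝔹 n)) (2^⊗δ₁ n) ⟩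
    ((fromℕ 2 ^5 n ⊗ 𝔹 n ⊕ ((fromℕ 2 ⊗ δ₁ n) ⊖ (fromℕ 2 ⊗ δ₁ n)) ⊕ (𝔹₂ ⋆ 𝟏) n)) ⊖ (fromℕ 2 ⊗ 𝔹 n)
      ≡⟨ collapse (fromℕ 2 ^5 n ⊗ 𝔹 n) (fromℕ 2 ⊗ δ₁ n) ((𝔹₂ ⋆ 𝟏) n) (fromℕ 2 ⊗ 𝔹 n) ⟩
    G n ∎
    where
    open ≡-Reasoning
    expand : ∀ p t b d s → (p ⊗ (b ⊕ d) ⊕ s) ⊖ (t ⊗ (b ⊕ d)) ≡ (p ⊗ b ⊕ ((p ⊗ d) ⊖ (t ⊗ d)) ⊕ s) ⊖ (t ⊗ b)
    expand = solve-∀ ℚ√5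
    collapse : ∀ a e s c → (a ⊕ (e ⊖ e) ⊕ s) ⊖ c ≡ (s ⊕ a) ⊖ c
    collapse = solve-∀ ℚ√5

divShift₂ : (ℕ → Q5) → ℕ → Q5
divShift₂ g i = g (suc (suc i)) ⊗ 1/ suc (suc i)

⋆𝟏-difference : ∀ n (f : ℕ → Q5) → ((f ∘ suc) ⋆ 𝟏) n ≡ (f ⋆ 𝟏) (suc n) ⊖ (f ⋆ 𝟏) n
⋆𝟏-difference n f = begin
  ((f ∘ suc) ⋆ 𝟏) n                                       ≡⟨ sym (cancel (((f ∘ suc) ⋆ 𝟏) n) ((f ⋆ 𝟏) n)) ⟩
  (((f ∘ suc) ⋆ 𝟏) n ⊕ (f ⋆ 𝟏) n) ⊖ (f ⋆ 𝟏) n             ≡⟨ cong (λ x → (((f ∘ suc) ⋆ 𝟏) n ⊕ x) ⊖ (f ⋆ 𝟏) n) (⋆-congʳ n f (λ k _ → sym (⊗-identityˡ (𝟏 k)))) ⟩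
  (((f ∘ suc) ⋆ 𝟏) n ⊕ (f ⋆ (𝟏 ∘ suc)) n) ⊖ (f ⋆ 𝟏) n     ≡⟨ cong (_⊖ (f ⋆ 𝟏) n) (sym (⋆-suc n f 𝟏)) ⟩
  (f ⋆ 𝟏) (suc n) ⊖ (f ⋆ 𝟏) n                             ∎
  where
  open ≡-Reasoning
  cancel : ∀ x y → (x ⊕ y) ⊖ y ≡ x
  cancel = solve-∀ ℚ√5

divShift₂-⋆𝟏 : ∀ r (g : ℕ → Q5) →
  fromℕ (pronic r) ⊗ (divShift₂ g ⋆ 𝟏) r ≡ ((fromℕ (suc (suc r)) ⊗ ((g ⋆ 𝟏) (suc (suc r)) ⊖ (g ⋆ 𝟏) (suc r))) ⊖ (g ⋆ 𝟏) (suc (suc r))) ⊕ g 0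
divShift₂-⋆𝟏 r g = begin
  fromℕ (pronic r) ⊗ (divShift₂ g ⋆ 𝟏) r
    ≡⟨ cong (fromℕ (pronic r) ⊗_) (⋆𝟏-unfold r (divShift₂ g)) ⟩
  fromℕ (pronic r) ⊗ ΣQ5 r (λ i → fromℕ (r C i) ⊗ divShift₂ g i)
    ≡⟨ sym (ΣQ5-⊗ r (fromℕ (pronic r)) _) ⟩
  ΣQ5 r (λ i → fromℕ (pronic r) ⊗ (fromℕ (r C i) ⊗ divShift₂ g i))
    ≡⟨ ΣQ5-cong r (λ i _ → term i) ⟩
  ΣQ5 r (λ i → (fromℕ (suc (suc r)) ⊗ (fromℕ (suc r C suc i) ⊗ g (suc (suc i)))) ⊖ (fromℕ (suc (suc r) C suc (suc i)) ⊗ g (suc (suc i))))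
    ≡⟨ trans (ΣQ5-⊕ r _ _) (cong₂ _⊕_ (ΣQ5-⊗ r (fromℕ (suc (suc r))) _) (ΣQ5-⊖ r _)) ⟩
  (fromℕ (suc (suc r)) ⊗ Y) ⊖ X
    ≡⟨ sym (regroup (fromℕ (suc (suc r))) (g 0) (g 1) X Y) ⟩
  ((fromℕ (suc (suc r)) ⊗ (g 1 ⊕ Y)) ⊖ (g 0 ⊕ (fromℕ (suc (suc r)) ⊗ g 1 ⊕ X))) ⊕ g 0
    ≡⟨ sym (cong₂ (λ y x → ((fromℕ (suc (suc r)) ⊗ y) ⊖ x) ⊕ g 0) unfold-Y unfold-X) ⟩
  ((fromℕ (suc (suc r)) ⊗ ((g ∘ suc) ⋆ 𝟏) (suc r)) ⊖ (g ⋆ 𝟏) (suc (suc r))) ⊕ g 0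
    ≡⟨ cong (λ y → ((fromℕ (suc (suc r)) ⊗ y) ⊖ (g ⋆ 𝟏) (suc (suc r))) ⊕ g 0) (⋆𝟏-difference (suc r) g) ⟩
  ((fromℕ (suc (suc r)) ⊗ ((g ⋆ 𝟏) (suc (suc r)) ⊖ (g ⋆ 𝟏) (suc r))) ⊖ (g ⋆ 𝟏) (suc (suc r))) ⊕ g 0 ∎
  where
  open ≡-Reasoning
  X Y : Q5
  X = ΣQ5 r (λ i → fromℕ (suc (suc r) C suc (suc i)) ⊗ g (suc (suc i)))
  Y = ΣQ5 r (λ i → fromℕ (suc r C suc i) ⊗ g (suc (suc i)))
  regroup : ∀ n g₀ g₁ x y → ((n ⊗ (g₁ ⊕ y)) ⊖ (g₀ ⊕ (n ⊗ g₁ ⊕ x))) ⊕ g₀ ≡ (n ⊗ y) ⊖ x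
  regroup = solve-∀ ℚ√5
  unfold-X : (g ⋆ 𝟏) (suc (suc r)) ≡ g 0 ⊕ (fromℕ (suc (suc r)) ⊗ g 1 ⊕ X)
  unfold-X = begin
    (g ⋆ 𝟏) (suc (suc r))
      ≡⟨ ⋆𝟏-unfold (suc (suc r)) g ⟩
    ΣQ5 (suc (suc r)) (λ k → fromℕ (suc (suc r) C k) ⊗ g k)
      ≡⟨ ΣQ5-unfoldˡ (suc r) _ ⟩
    𝟙 ⊗ g 0 ⊕ ΣQ5 (suc r) (λ k → fromℕ (suc (suc r) C suc k) ⊗ g (suc k))
      ≡⟨ cong₂ _⊕_ (⊗-identityˡ (g 0)) (ΣQ5-unfoldˡ r _) ⟩
    g 0 ⊕ (fromℕ (suc (suc r) C 1) ⊗ g 1 ⊕ X)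
      ≡⟨ cong (λ c → g 0 ⊕ (fromℕ c ⊗ g 1 ⊕ X)) (nC1≡n (suc (suc r))) ⟩
    g 0 ⊕ (fromℕ (suc (suc r)) ⊗ g 1 ⊕ X) ∎
  unfold-Y : ((g ∘ suc) ⋆ 𝟏) (suc r) ≡ g 1 ⊕ Y
  unfold-Y = begin
    ((g ∘ suc) ⋆ 𝟏) (suc r)
      ≡⟨ ⋆𝟏-unfold (suc r) (g ∘ suc) ⟩
    ΣQ5 (suc r) (λ k → fromℕ (suc r C k) ⊗ g (suc k))
      ≡⟨ ΣQ5-unfoldˡ r _ ⟩
    𝟙 ⊗ g 1 ⊕ Y
      ≡⟨ cong (_⊕ Y) (⊗-identityˡ (g 1)) ⟩
    g 1 ⊕ Y ∎
  term : ∀ i → fromℕ (pronic r) ⊗ (fromℕ (r C i) ⊗ divShift₂ g i)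
             ≡ (fromℕ (suc (suc r)) ⊗ (fromℕ (suc r C suc i) ⊗ g (suc (suc i)))) ⊖ (fromℕ (suc (suc r) C suc (suc i)) ⊗ g (suc (suc i)))
  term i = begin
    fromℕ (pronic r) ⊗ (fromℕ (r C i) ⊗ (G ⊗ I))
      ≡⟨ reassoc (fromℕ (pronic r)) (fromℕ (r C i)) G I ⟩
    (fromℕ (pronic r) ⊗ fromℕ (r C i)) ⊗ G ⊗ I
      ≡⟨ cong (λ w → w ⊗ G ⊗ I) (sym (fromℕ-* (pronic r) (r C i))) ⟩
    fromℕ (pronic r N.* (r C i)) ⊗ G ⊗ I
      ≡⟨ cong (λ m → fromℕ m ⊗ G ⊗ I) top-count ⟩
    fromℕ (suc (suc r) N.* (suc r C suc i) N.* suc i) ⊗ G ⊗ I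
      ≡⟨ cong (λ w → w ⊗ G ⊗ I) (fromℕ-* (suc (suc r) N.* (suc r C suc i)) (suc i)) ⟩
    W ⊗ a ⊗ G ⊗ I
      ≡⟨ fraction W a G I ⟩
    ((W ⊗ G) ⊖ ((W ⊗ I) ⊗ G)) ⊕ (W ⊗ G) ⊗ ((I ⊗ (𝟙 ⊕ a)) ⊖ 𝟙)
      ≡⟨ cong (λ u → ((W ⊗ G) ⊖ ((W ⊗ I) ⊗ G)) ⊕ (W ⊗ G) ⊗ (u ⊖ 𝟙)) I⊗[i+2]≡𝟙 ⟩
    ((W ⊗ G) ⊖ ((W ⊗ I) ⊗ G)) ⊕ (W ⊗ G) ⊗ (𝟙 ⊖ 𝟙)
      ≡⟨ tidy (W ⊗ G) ((W ⊗ I) ⊗ G) ⟩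
    (W ⊗ G) ⊖ ((W ⊗ I) ⊗ G)
      ≡⟨ cong₂ (λ u v → (u ⊗ G) ⊖ (v ⊗ G)) (fromℕ-* (suc (suc r)) (suc r C suc i)) (sym X-coefficient) ⟩
    (fromℕ (suc (suc r)) ⊗ fromℕ (suc r C suc i) ⊗ G) ⊖ (fromℕ (suc (suc r) C suc (suc i)) ⊗ G)
      ≡⟨ cong (_⊖ (fromℕ (suc (suc r) C suc (suc i)) ⊗ G)) (⊗-assoc (fromℕ (suc (suc r))) (fromℕ (suc r C suc i)) G) ⟩
    (fromℕ (suc (suc r)) ⊗ (fromℕ (suc r C suc i) ⊗ G)) ⊖ (fromℕ (suc (suc r) C suc (suc i)) ⊗ G) ∎
    where
    G I a W : Q5
    G = g (suc (suc i))
    I = 1/ suc (suc i)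
    a = fromℕ (suc i)
    W = fromℕ (suc (suc r) N.* (suc r C suc i))
    reassoc : ∀ p c x y → p ⊗ (c ⊗ (x ⊗ y)) ≡ (p ⊗ c) ⊗ x ⊗ y
    reassoc = solve-∀ ℚ√5
    fraction : ∀ w a x i → w ⊗ a ⊗ x ⊗ i ≡ ((w ⊗ x) ⊖ ((w ⊗ i) ⊗ x)) ⊕ (w ⊗ x) ⊗ ((i ⊗ (𝟙 ⊕ a)) ⊖ 𝟙)
    fraction = solve-∀ ℚ√5
    tidy : ∀ u v → (u ⊖ v) ⊕ u ⊗ (𝟙 ⊖ 𝟙) ≡ u ⊖ v
    tidy = solve-∀ ℚ√5
    I⊗[i+2]≡𝟙 : I ⊗ (𝟙 ⊕ a) ≡ 𝟙
    I⊗[i+2]≡𝟙 = trans (cong (I ⊗_) (sym (fromℕ-+ 1 (suc i)))) (1/-inverseˡ (suc (suc i)) (λ ()))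
    top-count : pronic r N.* (r C i) ≡ suc (suc r) N.* (suc r C suc i) N.* suc i
    top-count = begin
      suc r N.* suc (suc r) N.* (r C i)            ≡⟨ rearrange (suc r) (suc (suc r)) (r C i) ⟩
      suc (suc r) N.* (suc r N.* (r C i))          ≡⟨ cong (suc (suc r) N.*_) (sym (C-absorb r i)) ⟩
      suc (suc r) N.* (suc i N.* (suc r C suc i))  ≡⟨ rearrange′ (suc (suc r)) (suc i) (suc r C suc i) ⟩
      suc (suc r) N.* (suc r C suc i) N.* suc i    ∎
      where
      rearrange : ∀ a b c → a N.* b N.* c ≡ b N.* (a N.* c)
      rearrange = ℕ-solve-∀
      rearrange′ : ∀ a b c → a N.* (b N.* c) ≡ a N.* c N.* b
      rearrange′ = ℕ-solve-∀
    X-coefficient : fromℕ (suc (suc r) C suc (suc i)) ≡ W ⊗ I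
    X-coefficient = fromℕ-quotient (suc (suc r) C suc (suc i)) (suc (suc i)) (λ ())
                      (trans (N.*-comm (suc (suc r) C suc (suc i)) (suc (suc i))) (C-absorb (suc r) (suc i)))

bern/ dupBern/ oddBern/ : ℕ → Q5
bern/ = divShift₂ 𝔹
dupBern/ = divShift₂ (λ m → 𝔹₂ m ⊖ 𝔹 m)
oddBern/ i = if isEven i then 𝟘 else 𝔹 (suc i) ⊗ 1/ suc i

pronic⊗1/pronic : ∀ r → fromℕ (pronic r) ⊗ 1/ pronic r ≡ 𝟙
pronic⊗1/pronic r = trans (⊗-comm (fromℕ (pronic r)) (1/ pronic r)) (1/-inverseˡ (pronic r) (λ ()))

private
  cancel-factor : ∀ a n x i → i ⊗ n ≡ 𝟙 → (a ⊗ n) ⊗ (x ⊗ i) ≡ a ⊗ x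
  cancel-factor a n x i i⊗n≡𝟙 = trans (regroup a n x i) (trans (cong ((a ⊗ x) ⊗_) i⊗n≡𝟙) (⊗-identityʳ (a ⊗ x)))
    where
    regroup : ∀ a n x i → (a ⊗ n) ⊗ (x ⊗ i) ≡ (a ⊗ x) ⊗ (i ⊗ n)
    regroup = solve-∀ ℚ√5

pronic⊗1/suc-suc : ∀ r x → fromℕ (pronic r) ⊗ (x ⊗ 1/ suc (suc r)) ≡ fromℕ (suc r) ⊗ x
pronic⊗1/suc-suc r x = trans (cong (_⊗ (x ⊗ 1/ suc (suc r))) (fromℕ-* (suc r) (suc (suc r))))
                             (cancel-factor (fromℕ (suc r)) (fromℕ (suc (suc r))) x (1/ suc (suc r)) (1/-inverseˡ (suc (suc r)) (λ ())))

pronic⊗1/suc : ∀ r x → fromℕ (pronic r) ⊗ (x ⊗ 1/ suc r) ≡ fromℕ (suc (suc r)) ⊗ x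
pronic⊗1/suc r x = trans (cong (_⊗ (x ⊗ 1/ suc r)) (trans (fromℕ-* (suc r) (suc (suc r))) (⊗-comm (fromℕ (suc r)) (fromℕ (suc (suc r))))))
                         (cancel-factor (fromℕ (suc (suc r))) (fromℕ (suc r)) x (1/ suc r) (1/-inverseˡ (suc r) (λ ())))

bern/⋆𝟏-odd : ∀ r → isEven r ≡ true → (bern/ ⋆ 𝟏) (suc r) ≡ (1/ pronic (suc r)) ⊖ (𝔹 (suc (suc r)) ⊗ 1/ suc (suc r))
bern/⋆𝟏-odd r r-even = fromℕ-cancelˡ (pronic (suc r)) (λ ()) (begin
  p ⊗ (bern/ ⋆ 𝟏) (suc r)
    ≡⟨ divShift₂-⋆𝟏 (suc r) 𝔹 ⟩
  ((n ⊗ ((𝔹 ⋆ 𝟏) (suc (suc (suc r))) ⊖ (𝔹 ⋆ 𝟏) (suc (suc r)))) ⊖ (𝔹 ⋆ 𝟏) (suc (suc (suc r)))) ⊕ 𝟙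
    ≡⟨ cong₂ (λ x y → ((n ⊗ (x ⊖ y)) ⊖ x) ⊕ 𝟙) (𝔹⋆𝟏 (suc (suc (suc r)))) (𝔹⋆𝟏 (suc (suc r))) ⟩
  ((n ⊗ ((b₃ ⊕ 𝟘) ⊖ (b₂ ⊕ 𝟘))) ⊖ (b₃ ⊕ 𝟘)) ⊕ 𝟙
    ≡⟨ cong (λ x → ((n ⊗ ((x ⊕ 𝟘) ⊖ (b₂ ⊕ 𝟘))) ⊖ (x ⊕ 𝟘)) ⊕ 𝟙) (𝔹-odd (suc r) (even⇒suc-odd r r-even)) ⟩
  ((n ⊗ ((𝟘 ⊕ 𝟘) ⊖ (b₂ ⊕ 𝟘))) ⊖ (𝟘 ⊕ 𝟘)) ⊕ 𝟙
    ≡⟨ simplify n b₂ ⟩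
  𝟙 ⊖ (n ⊗ b₂)
    ≡⟨ sym (cong₂ _⊖_ (pronic⊗1/pronic (suc r)) (pronic⊗1/suc (suc r) b₂)) ⟩
  (p ⊗ 1/ pronic (suc r)) ⊖ (p ⊗ (b₂ ⊗ 1/ suc (suc r)))
    ≡⟨ factor p (1/ pronic (suc r)) (b₂ ⊗ 1/ suc (suc r)) ⟩
  p ⊗ ((1/ pronic (suc r)) ⊖ (b₂ ⊗ 1/ suc (suc r))) ∎)
  where
  open ≡-Reasoning
  p n b₂ b₃ : Q5
  p = fromℕ (pronic (suc r))
  n = fromℕ (suc (suc (suc r)))
  b₂ = 𝔹 (suc (suc r))
  b₃ = 𝔹 (suc (suc (suc r)))
  simplify : ∀ n b → ((n ⊗ ((𝟘 ⊕ 𝟘) ⊖ (b ⊕ 𝟘))) ⊖ (𝟘 ⊕ 𝟘)) ⊕ 𝟙 ≡ 𝟙 ⊖ (n ⊗ b)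
  simplify = solve-∀ ℚ√5
  factor : ∀ p x y → (p ⊗ x) ⊖ (p ⊗ y) ≡ p ⊗ (x ⊖ y)
  factor = solve-∀ ℚ√5

bern/⋆𝟏-even : ∀ r → isEven r ≡ true → (bern/ ⋆ 𝟏) (suc (suc r)) ≡ bern/ (suc (suc r)) ⊕ 1/ pronic (suc (suc r))
bern/⋆𝟏-even r r-even = fromℕ-cancelˡ (pronic R) (λ ()) (begin
  p ⊗ (bern/ ⋆ 𝟏) R
    ≡⟨ divShift₂-⋆𝟏 R 𝔹 ⟩
  ((n ⊗ ((𝔹 ⋆ 𝟏) (suc (suc R)) ⊖ (𝔹 ⋆ 𝟏) (suc R))) ⊖ (𝔹 ⋆ 𝟏) (suc (suc R))) ⊕ 𝟙
    ≡⟨ cong₂ (λ x y → ((n ⊗ (x ⊖ y)) ⊖ x) ⊕ 𝟙) (𝔹⋆𝟏 (suc (suc R))) (𝔹⋆𝟏 (suc R)) ⟩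
  ((n ⊗ ((b₄ ⊕ 𝟘) ⊖ (b₃ ⊕ 𝟘))) ⊖ (b₄ ⊕ 𝟘)) ⊕ 𝟙
    ≡⟨ cong₂ (λ m y → ((m ⊗ ((b₄ ⊕ 𝟘) ⊖ (y ⊕ 𝟘))) ⊖ (b₄ ⊕ 𝟘)) ⊕ 𝟙) (fromℕ-+ 1 (suc R)) (𝔹-odd (suc r) (even⇒suc-odd r r-even)) ⟩
  (((𝟙 ⊕ a) ⊗ ((b₄ ⊕ 𝟘) ⊖ (𝟘 ⊕ 𝟘))) ⊖ (b₄ ⊕ 𝟘)) ⊕ 𝟙
    ≡⟨ simplify a b₄ ⟩
  a ⊗ b₄ ⊕ 𝟙
    ≡⟨ sym (cong₂ _⊕_ (pronic⊗1/suc-suc R b₄) (pronic⊗1/pronic R)) ⟩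
  p ⊗ bern/ R ⊕ p ⊗ 1/ pronic R
    ≡⟨ sym (⊗-distribˡ-⊕ p (bern/ R) (1/ pronic R)) ⟩
  p ⊗ (bern/ R ⊕ 1/ pronic R) ∎)
  where
  open ≡-Reasoning
  R : ℕ
  R = suc (suc r)
  p n a b₃ b₄ : Q5
  p = fromℕ (pronic R)
  n = fromℕ (suc (suc R))
  a = fromℕ (suc R)
  b₃ = 𝔹 (suc R)
  b₄ = 𝔹 (suc (suc R))
  simplify : ∀ a b → (((𝟙 ⊕ a) ⊗ ((b ⊕ 𝟘) ⊖ (𝟘 ⊕ 𝟘))) ⊖ (b ⊕ 𝟘)) ⊕ 𝟙 ≡ a ⊗ b ⊕ 𝟙
  simplify = solve-∀ ℚ√5

dup⋆𝟏 : ∀ n → ((λ m → 𝔹₂ m ⊖ 𝔹 m) ⋆ 𝟏) n ≡ (⊖ (𝔹₂ n ⊖ 𝔹 n)) ⊖ δ₁ n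
dup⋆𝟏 n = begin
  ((λ m → 𝔹₂ m ⊖ 𝔹 m) ⋆ 𝟏) n                        ≡⟨ trans (⋆-⊕ˡ n 𝔹₂ (λ m → ⊖ 𝔹 m) 𝟏) (cong ((𝔹₂ ⋆ 𝟏) n ⊕_) (⋆-⊖ˡ n 𝔹 𝟏)) ⟩
  (𝔹₂ ⋆ 𝟏) n ⊖ (𝔹 ⋆ 𝟏) n                            ≡⟨ cong₂ _⊖_ (𝔹-duplication n) (𝔹⋆𝟏 n) ⟩
  ((fromℕ 2 ⊗ 𝔹 n) ⊖ 𝔹₂ n) ⊖ (𝔹 n ⊕ δ₁ n)           ≡⟨ simplify (𝔹 n) (𝔹₂ n) (δ₁ n) ⟩
  (⊖ (𝔹₂ n ⊖ 𝔹 n)) ⊖ δ₁ n                           ∎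
  where
  open ≡-Reasoning
  simplify : ∀ b b₂ d → (((𝟙 ⊕ 𝟙) ⊗ b) ⊖ b₂) ⊖ (b ⊕ d) ≡ (⊖ (b₂ ⊖ b)) ⊖ d
  simplify = solve-∀ ℚ√5

dupBern/⋆𝟏-even : ∀ r → isEven r ≡ true → (dupBern/ ⋆ 𝟏) (suc (suc r)) ≡ ⊖ dupBern/ (suc (suc r))
dupBern/⋆𝟏-even r r-even = fromℕ-cancelˡ (pronic R) (λ ()) (begin
  p ⊗ (dupBern/ ⋆ 𝟏) R
    ≡⟨ divShift₂-⋆𝟏 R g ⟩
  ((n ⊗ ((g ⋆ 𝟏) (suc (suc R)) ⊖ (g ⋆ 𝟏) (suc R))) ⊖ (g ⋆ 𝟏) (suc (suc R))) ⊕ g 0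
    ≡⟨ cong₂ (λ x y → ((n ⊗ (x ⊖ y)) ⊖ x) ⊕ g 0) (dup⋆𝟏 (suc (suc R))) (dup⋆𝟏 (suc R)) ⟩
  ((n ⊗ (((⊖ g₄) ⊖ 𝟘) ⊖ ((⊖ g₃) ⊖ 𝟘))) ⊖ ((⊖ g₄) ⊖ 𝟘)) ⊕ g 0
    ≡⟨ cong₂ (λ m y → ((m ⊗ (((⊖ g₄) ⊖ 𝟘) ⊖ ((⊖ y) ⊖ 𝟘))) ⊖ ((⊖ g₄) ⊖ 𝟘)) ⊕ g 0) (fromℕ-+ 1 (suc R)) g₃≡𝟘 ⟩
  (((𝟙 ⊕ a) ⊗ (((⊖ g₄) ⊖ 𝟘) ⊖ ((⊖ 𝟘) ⊖ 𝟘))) ⊖ ((⊖ g₄) ⊖ 𝟘)) ⊕ 𝟘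
    ≡⟨ simplify a g₄ ⟩
  ⊖ (a ⊗ g₄)
    ≡⟨ cong (λ x → ⊖ x) (sym (pronic⊗1/suc-suc R g₄)) ⟩
  ⊖ (p ⊗ dupBern/ R)
    ≡⟨ ⊖-pull p (dupBern/ R) ⟩
  p ⊗ (⊖ dupBern/ R) ∎)
  where
  open ≡-Reasoning
  g : ℕ → Q5
  g m = 𝔹₂ m ⊖ 𝔹 m
  R : ℕ
  R = suc (suc r)
  p n a g₃ g₄ : Q5
  p = fromℕ (pronic R)
  n = fromℕ (suc (suc R))
  a = fromℕ (suc R)
  g₃ = g (suc R)
  g₄ = g (suc (suc R))
  g₃≡𝟘 : g₃ ≡ 𝟘
  g₃≡𝟘 = trans (cong (λ b → (fromℕ 2 ^5 suc R ⊗ b) ⊖ b) (𝔹-odd (suc r) (even⇒suc-odd r r-even))) (vanish (fromℕ 2 ^5 suc R))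
    where
    vanish : ∀ x → (x ⊗ 𝟘) ⊖ 𝟘 ≡ 𝟘
    vanish = solve-∀ ℚ√5
  simplify : ∀ a g → (((𝟙 ⊕ a) ⊗ (((⊖ g) ⊖ 𝟘) ⊖ ((⊖ 𝟘) ⊖ 𝟘))) ⊖ ((⊖ g) ⊖ 𝟘)) ⊕ 𝟘 ≡ ⊖ (a ⊗ g)
  simplify = solve-∀ ℚ√5
  ⊖-pull : ∀ p x → ⊖ (p ⊗ x) ≡ p ⊗ (⊖ x)
  ⊖-pull = solve-∀ ℚ√5

bern/-even-coefficient : ∀ r → ((𝟙 ⊕ σ r) ⊗ (bern/ ⋆ 𝟏) r) ⊖ (fromℕ 2 ⊗ bern/ r) ≡ ((𝟙 ⊕ σ r) ⊗ 1/ pronic r) ⊖ δ₀ r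
bern/-even-coefficient zero = refl
bern/-even-coefficient (suc zero) = refl
bern/-even-coefficient (suc (suc r)) = by-parity (isEven r) refl
  where
  R : ℕ
  R = suc (suc r)
  by-parity : ∀ b → isEven r ≡ b → ((𝟙 ⊕ σ R) ⊗ (bern/ ⋆ 𝟏) R) ⊖ (fromℕ 2 ⊗ bern/ R) ≡ ((𝟙 ⊕ σ R) ⊗ 1/ pronic R) ⊖ δ₀ R
  by-parity true r-even = begin
    ((𝟙 ⊕ σ R) ⊗ (bern/ ⋆ 𝟏) R) ⊖ (fromℕ 2 ⊗ bern/ R)        ≡⟨ cong₂ (λ s t → ((𝟙 ⊕ s) ⊗ t) ⊖ (fromℕ 2 ⊗ bern/ R)) (σ-even R (trans (isEven-suc-suc r) r-even)) (bern/⋆𝟏-even r r-even) ⟩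
    ((𝟙 ⊕ 𝟙) ⊗ (bern/ R ⊕ 1/ pronic R)) ⊖ ((𝟙 ⊕ 𝟙) ⊗ bern/ R) ≡⟨ simplify (bern/ R) (1/ pronic R) ⟩
    ((𝟙 ⊕ 𝟙) ⊗ 1/ pronic R) ⊖ 𝟘                               ≡⟨ cong (λ s → ((𝟙 ⊕ s) ⊗ 1/ pronic R) ⊖ 𝟘) (sym (σ-even R (trans (isEven-suc-suc r) r-even))) ⟩
    ((𝟙 ⊕ σ R) ⊗ 1/ pronic R) ⊖ 𝟘                             ∎
    where
    open ≡-Reasoning
    simplify : ∀ b i → ((𝟙 ⊕ 𝟙) ⊗ (b ⊕ i)) ⊖ ((𝟙 ⊕ 𝟙) ⊗ b) ≡ ((𝟙 ⊕ 𝟙) ⊗ i) ⊖ 𝟘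
    simplify = solve-∀ ℚ√5
  by-parity false r-odd = begin
    ((𝟙 ⊕ σ R) ⊗ (bern/ ⋆ 𝟏) R) ⊖ (fromℕ 2 ⊗ bern/ R)        ≡⟨ cong₂ (λ s b → ((𝟙 ⊕ s) ⊗ (bern/ ⋆ 𝟏) R) ⊖ (fromℕ 2 ⊗ (b ⊗ 1/ suc (suc R)))) (σ-odd R R-odd) (𝔹-odd R R-odd) ⟩
    ((𝟙 ⊕ ⊖ 𝟙) ⊗ (bern/ ⋆ 𝟏) R) ⊖ (fromℕ 2 ⊗ (𝟘 ⊗ 1/ suc (suc R))) ≡⟨ simplify ((bern/ ⋆ 𝟏) R) (fromℕ 2) (1/ suc (suc R)) (1/ pronic R) ⟩
    ((𝟙 ⊕ ⊖ 𝟙) ⊗ 1/ pronic R) ⊖ 𝟘                             ≡⟨ cong (λ s → ((𝟙 ⊕ s) ⊗ 1/ pronic R) ⊖ 𝟘) (sym (σ-odd R R-odd)) ⟩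
    ((𝟙 ⊕ σ R) ⊗ 1/ pronic R) ⊖ 𝟘                             ∎
    where
    open ≡-Reasoning
    R-odd : isEven R ≡ false
    R-odd = trans (isEven-suc-suc r) r-odd
    simplify : ∀ s t i j → ((𝟙 ⊕ ⊖ 𝟙) ⊗ s) ⊖ (t ⊗ (𝟘 ⊗ i)) ≡ ((𝟙 ⊕ ⊖ 𝟙) ⊗ j) ⊖ 𝟘
    simplify = solve-∀ ℚ√5

oddBern/-coefficient : ∀ r → ((𝟙 ⊖ σ r) ⊗ (bern/ ⋆ 𝟏) r) ⊕ (fromℕ 2 ⊗ oddBern/ r) ≡ (𝟙 ⊖ σ r) ⊗ 1/ pronic r
oddBern/-coefficient zero = refl
oddBern/-coefficient (suc r) = by-parity (isEven r) refl
  where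
  by-parity : ∀ b → isEven r ≡ b → ((𝟙 ⊖ σ (suc r)) ⊗ (bern/ ⋆ 𝟏) (suc r)) ⊕ (fromℕ 2 ⊗ oddBern/ (suc r)) ≡ (𝟙 ⊖ σ (suc r)) ⊗ 1/ pronic (suc r)
  by-parity true r-even = begin
    ((𝟙 ⊖ σ (suc r)) ⊗ (bern/ ⋆ 𝟏) (suc r)) ⊕ (fromℕ 2 ⊗ oddBern/ (suc r))
      ≡⟨ cong₂ (λ s u → ((𝟙 ⊖ s) ⊗ (bern/ ⋆ 𝟏) (suc r)) ⊕ (fromℕ 2 ⊗ u)) (σ-odd (suc r) 1+r-odd) (cong (λ b → if b then 𝟘 else z) 1+r-odd) ⟩
    ((𝟙 ⊖ (⊖ 𝟙)) ⊗ (bern/ ⋆ 𝟏) (suc r)) ⊕ ((𝟙 ⊕ 𝟙) ⊗ z)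
      ≡⟨ cong (λ t → ((𝟙 ⊖ (⊖ 𝟙)) ⊗ t) ⊕ ((𝟙 ⊕ 𝟙) ⊗ z)) (bern/⋆𝟏-odd r r-even) ⟩
    ((𝟙 ⊖ (⊖ 𝟙)) ⊗ ((1/ pronic (suc r)) ⊖ z)) ⊕ ((𝟙 ⊕ 𝟙) ⊗ z)
      ≡⟨ simplify (1/ pronic (suc r)) z ⟩
    (𝟙 ⊖ (⊖ 𝟙)) ⊗ 1/ pronic (suc r)
      ≡⟨ cong (λ s → (𝟙 ⊖ s) ⊗ 1/ pronic (suc r)) (sym (σ-odd (suc r) 1+r-odd)) ⟩
    (𝟙 ⊖ σ (suc r)) ⊗ 1/ pronic (suc r) ∎
    where
    open ≡-Reasoning
    z : Q5
    z = 𝔹 (suc (suc r)) ⊗ 1/ suc (suc r)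
    1+r-odd : isEven (suc r) ≡ false
    1+r-odd = even⇒suc-odd r r-even
    simplify : ∀ i z → ((𝟙 ⊖ (⊖ 𝟙)) ⊗ (i ⊖ z)) ⊕ ((𝟙 ⊕ 𝟙) ⊗ z) ≡ (𝟙 ⊖ (⊖ 𝟙)) ⊗ i
    simplify = solve-∀ ℚ√5
  by-parity false r-odd = begin
    ((𝟙 ⊖ σ (suc r)) ⊗ (bern/ ⋆ 𝟏) (suc r)) ⊕ (fromℕ 2 ⊗ oddBern/ (suc r))
      ≡⟨ cong₂ (λ s u → ((𝟙 ⊖ s) ⊗ (bern/ ⋆ 𝟏) (suc r)) ⊕ (fromℕ 2 ⊗ u)) (σ-even (suc r) 1+r-even) (cong (λ b → if b then 𝟘 else 𝔹 (suc (suc r)) ⊗ 1/ suc (suc r)) 1+r-even) ⟩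
    ((𝟙 ⊖ 𝟙) ⊗ (bern/ ⋆ 𝟏) (suc r)) ⊕ (fromℕ 2 ⊗ 𝟘)
      ≡⟨ simplify ((bern/ ⋆ 𝟏) (suc r)) (fromℕ 2) (1/ pronic (suc r)) ⟩
    (𝟙 ⊖ 𝟙) ⊗ 1/ pronic (suc r)
      ≡⟨ cong (λ s → (𝟙 ⊖ s) ⊗ 1/ pronic (suc r)) (sym (σ-even (suc r) 1+r-even)) ⟩
    (𝟙 ⊖ σ (suc r)) ⊗ 1/ pronic (suc r) ∎
    where
    open ≡-Reasoning
    1+r-even : isEven (suc r) ≡ true
    1+r-even = odd⇒suc-even r r-odd
    simplify : ∀ s t i → ((𝟙 ⊖ 𝟙) ⊗ s) ⊕ (t ⊗ 𝟘) ≡ (𝟙 ⊖ 𝟙) ⊗ i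
    simplify = solve-∀ ℚ√5

dupBern/-coefficient : ∀ r → ((𝟙 ⊕ σ r) ⊗ (dupBern/ ⋆ 𝟏) r) ⊕ (fromℕ 2 ⊗ dupBern/ r) ≡ δ₀ r
dupBern/-coefficient zero = refl
dupBern/-coefficient (suc zero) = refl
dupBern/-coefficient (suc (suc r)) = by-parity (isEven r) refl
  where
  R : ℕ
  R = suc (suc r)
  by-parity : ∀ b → isEven r ≡ b → ((𝟙 ⊕ σ R) ⊗ (dupBern/ ⋆ 𝟏) R) ⊕ (fromℕ 2 ⊗ dupBern/ R) ≡ δ₀ R
  by-parity true r-even = begin
    ((𝟙 ⊕ σ R) ⊗ (dupBern/ ⋆ 𝟏) R) ⊕ (fromℕ 2 ⊗ dupBern/ R)  ≡⟨ cong₂ (λ s t → ((𝟙 ⊕ s) ⊗ t) ⊕ (fromℕ 2 ⊗ dupBern/ R)) (σ-even R (trans (isEven-suc-suc r) r-even)) (dupBern/⋆𝟏-even r r-even) ⟩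
    ((𝟙 ⊕ 𝟙) ⊗ (⊖ dupBern/ R)) ⊕ ((𝟙 ⊕ 𝟙) ⊗ dupBern/ R)       ≡⟨ simplify (dupBern/ R) ⟩
    𝟘                                                        ∎
    where
    open ≡-Reasoning
    simplify : ∀ e → ((𝟙 ⊕ 𝟙) ⊗ (⊖ e)) ⊕ ((𝟙 ⊕ 𝟙) ⊗ e) ≡ 𝟘
    simplify = solve-∀ ℚ√5
  by-parity false r-odd = begin
    ((𝟙 ⊕ σ R) ⊗ (dupBern/ ⋆ 𝟏) R) ⊕ (fromℕ 2 ⊗ dupBern/ R)
      ≡⟨ cong₂ (λ s b → ((𝟙 ⊕ s) ⊗ (dupBern/ ⋆ 𝟏) R) ⊕ (fromℕ 2 ⊗ (((fromℕ 2 ^5 suc (suc R) ⊗ b) ⊖ b) ⊗ 1/ suc (suc R)))) (σ-odd R R-odd) (𝔹-odd R R-odd) ⟩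
    ((𝟙 ⊕ ⊖ 𝟙) ⊗ (dupBern/ ⋆ 𝟏) R) ⊕ (fromℕ 2 ⊗ (((fromℕ 2 ^5 suc (suc R) ⊗ 𝟘) ⊖ 𝟘) ⊗ 1/ suc (suc R)))
      ≡⟨ simplify ((dupBern/ ⋆ 𝟏) R) (fromℕ 2) (fromℕ 2 ^5 suc (suc R)) (1/ suc (suc R)) ⟩
    𝟘 ∎
    where
    open ≡-Reasoning
    R-odd : isEven R ≡ false
    R-odd = trans (isEven-suc-suc r) r-odd
    simplify : ∀ s t p i → ((𝟙 ⊕ ⊖ 𝟙) ⊗ s) ⊕ (t ⊗ (((p ⊗ 𝟘) ⊖ 𝟘) ⊗ i)) ≡ 𝟘
    simplify = solve-∀ ℚ√5

φ ψ : Q5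
φ = ½ +√5· ½
ψ = ½ +√5· (- ½)

φ²≡φ+1 : φ ⊗ φ ≡ φ ⊕ 𝟙
φ²≡φ+1 = refl

ψ²≡ψ+1 : ψ ⊗ ψ ≡ ψ ⊕ 𝟙
ψ²≡ψ+1 = refl

golden-recurrence : ∀ x → x ⊗ x ≡ x ⊕ 𝟙 → ∀ n → x ^5 suc (suc n) ≡ x ^5 suc n ⊕ x ^5 n
golden-recurrence x x²≡x+1 n = begin
  x ⊗ (x ⊗ x ^5 n)          ≡⟨ sym (⊗-assoc x x (x ^5 n)) ⟩
  (x ⊗ x) ⊗ x ^5 n          ≡⟨ cong (_⊗ x ^5 n) x²≡x+1 ⟩
  (x ⊕ 𝟙) ⊗ x ^5 n          ≡⟨ distrib x (x ^5 n) ⟩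
  x ⊗ x ^5 n ⊕ x ^5 n       ∎
  where
  open ≡-Reasoning
  distrib : ∀ x y → (x ⊕ 𝟙) ⊗ y ≡ x ⊗ y ⊕ y
  distrib = solve-∀ ℚ√5

Binet-L : ∀ n → φ ^5 n ⊕ ψ ^5 n ≡ fromℕ (L n)
Binet-L zero = refl
Binet-L (suc zero) = refl
Binet-L (suc (suc n)) = begin
  φ ^5 suc (suc n) ⊕ ψ ^5 suc (suc n)
    ≡⟨ cong₂ _⊕_ (golden-recurrence φ φ²≡φ+1 n) (golden-recurrence ψ ψ²≡ψ+1 n) ⟩
  (φ ^5 suc n ⊕ φ ^5 n) ⊕ (ψ ^5 suc n ⊕ ψ ^5 n)
    ≡⟨ interchange (φ ^5 suc n) (φ ^5 n) (ψ ^5 suc n) (ψ ^5 n) ⟩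
  (φ ^5 suc n ⊕ ψ ^5 suc n) ⊕ (φ ^5 n ⊕ ψ ^5 n)
    ≡⟨ cong₂ _⊕_ (Binet-L (suc n)) (Binet-L n) ⟩
  fromℕ (L (suc n)) ⊕ fromℕ (L n)
    ≡⟨ sym (fromℕ-+ (L (suc n)) (L n)) ⟩
  fromℕ (L (suc (suc n))) ∎
  where
  open ≡-Reasoning
  interchange : ∀ a b c d → (a ⊕ b) ⊕ (c ⊕ d) ≡ (a ⊕ c) ⊕ (b ⊕ d)
  interchange = solve-∀ ℚ√5

Binet-F : ∀ n → (φ ^5 n) ⊖ (ψ ^5 n) ≡ √5 ⊗ fromℕ (F n)
Binet-F zero = refl
Binet-F (suc zero) = refl
Binet-F (suc (suc n)) = begin
  (φ ^5 suc (suc n)) ⊖ (ψ ^5 suc (suc n))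
    ≡⟨ cong₂ _⊖_ (golden-recurrence φ φ²≡φ+1 n) (golden-recurrence ψ ψ²≡ψ+1 n) ⟩
  (φ ^5 suc n ⊕ φ ^5 n) ⊖ (ψ ^5 suc n ⊕ ψ ^5 n)
    ≡⟨ interchange (φ ^5 suc n) (φ ^5 n) (ψ ^5 suc n) (ψ ^5 n) ⟩
  ((φ ^5 suc n) ⊖ (ψ ^5 suc n)) ⊕ ((φ ^5 n) ⊖ (ψ ^5 n))
    ≡⟨ cong₂ _⊕_ (Binet-F (suc n)) (Binet-F n) ⟩
  √5 ⊗ fromℕ (F (suc n)) ⊕ √5 ⊗ fromℕ (F n)
    ≡⟨ trans (sym (⊗-distribˡ-⊕ √5 (fromℕ (F (suc n))) (fromℕ (F n)))) (cong (√5 ⊗_) (sym (fromℕ-+ (F (suc n)) (F n)))) ⟩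
  √5 ⊗ fromℕ (F (suc (suc n))) ∎
  where
  open ≡-Reasoning
  interchange : ∀ a b c d → (a ⊕ b) ⊖ (c ⊕ d) ≡ (a ⊖ c) ⊕ (b ⊖ d)
  interchange = solve-∀ ℚ√5

module _ (j : ℕ) where

  private
    ℓ Δ : Q5
    ℓ = fromℕ (L j)
    Δ = √5 ⊗ fromℕ (F j)

    scaled-power : ∀ x k → (fromℕ 2 ⊗ x ^5 j) ^5 k ≡ fromℕ (2 N.^ k) ⊗ x ^5 (j N.* k)
    scaled-power x k = trans (⊗-^5 (fromℕ 2) (x ^5 j) k) (cong₂ _⊗_ (sym (fromℕ-^ 2 k)) (sym (^5-* x j k)))

    ℓ⊕Δ≡2φ^j : ℓ ⊕ Δ ≡ fromℕ 2 ⊗ φ ^5 j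
    ℓ⊕Δ≡2φ^j = trans (cong₂ _⊕_ (sym (Binet-L j)) (sym (Binet-F j))) (sum-difference (φ ^5 j) (ψ ^5 j))
      where
      sum-difference : ∀ a b → (a ⊕ b) ⊕ (a ⊖ b) ≡ fromℕ 2 ⊗ a
      sum-difference = solve-∀ ℚ√5

    ℓ⊖Δ≡2ψ^j : ℓ ⊖ Δ ≡ fromℕ 2 ⊗ ψ ^5 j
    ℓ⊖Δ≡2ψ^j = trans (cong₂ _⊖_ (sym (Binet-L j)) (sym (Binet-F j))) (sum-difference (φ ^5 j) (ψ ^5 j))
      where
      sum-difference : ∀ a b → (a ⊕ b) ⊖ (a ⊖ b) ≡ fromℕ 2 ⊗ b
      sum-difference = solve-∀ ℚ√5

  Lucas-power-sum : ∀ k → (ℓ ⊕ Δ) ^5 k ⊕ (ℓ ⊖ Δ) ^5 k ≡ fromℕ (2 N.^ k N.* L (j N.* k))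
  Lucas-power-sum k = begin
    (ℓ ⊕ Δ) ^5 k ⊕ (ℓ ⊖ Δ) ^5 k
      ≡⟨ cong₂ (λ p m → p ^5 k ⊕ m ^5 k) ℓ⊕Δ≡2φ^j ℓ⊖Δ≡2ψ^j ⟩
    (fromℕ 2 ⊗ φ ^5 j) ^5 k ⊕ (fromℕ 2 ⊗ ψ ^5 j) ^5 k
      ≡⟨ cong₂ _⊕_ (scaled-power φ k) (scaled-power ψ k) ⟩
    fromℕ (2 N.^ k) ⊗ φ ^5 (j N.* k) ⊕ fromℕ (2 N.^ k) ⊗ ψ ^5 (j N.* k)
      ≡⟨ sym (⊗-distribˡ-⊕ (fromℕ (2 N.^ k)) (φ ^5 (j N.* k)) (ψ ^5 (j N.* k))) ⟩
    fromℕ (2 N.^ k) ⊗ (φ ^5 (j N.* k) ⊕ ψ ^5 (j N.* k))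
      ≡⟨ cong (fromℕ (2 N.^ k) ⊗_) (Binet-L (j N.* k)) ⟩
    fromℕ (2 N.^ k) ⊗ fromℕ (L (j N.* k))
      ≡⟨ sym (fromℕ-* (2 N.^ k) (L (j N.* k))) ⟩
    fromℕ (2 N.^ k N.* L (j N.* k)) ∎
    where open ≡-Reasoning

  Fibonacci-power-difference : ∀ k → ((ℓ ⊕ Δ) ^5 k) ⊖ ((ℓ ⊖ Δ) ^5 k) ≡ √5 ⊗ fromℕ (2 N.^ k N.* F (j N.* k))
  Fibonacci-power-difference k = begin
    ((ℓ ⊕ Δ) ^5 k) ⊖ ((ℓ ⊖ Δ) ^5 k)
      ≡⟨ cong₂ (λ p m → (p ^5 k) ⊖ (m ^5 k)) ℓ⊕Δ≡2φ^j ℓ⊖Δ≡2ψ^j ⟩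
    ((fromℕ 2 ⊗ φ ^5 j) ^5 k) ⊖ ((fromℕ 2 ⊗ ψ ^5 j) ^5 k)
      ≡⟨ cong₂ _⊖_ (scaled-power φ k) (scaled-power ψ k) ⟩
    (fromℕ (2 N.^ k) ⊗ φ ^5 (j N.* k)) ⊖ (fromℕ (2 N.^ k) ⊗ ψ ^5 (j N.* k))
      ≡⟨ factor (fromℕ (2 N.^ k)) (φ ^5 (j N.* k)) (ψ ^5 (j N.* k)) ⟩
    fromℕ (2 N.^ k) ⊗ ((φ ^5 (j N.* k)) ⊖ (ψ ^5 (j N.* k)))
      ≡⟨ cong (fromℕ (2 N.^ k) ⊗_) (Binet-F (j N.* k)) ⟩
    fromℕ (2 N.^ k) ⊗ (√5 ⊗ fromℕ (F (j N.* k)))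
      ≡⟨ regroup (fromℕ (2 N.^ k)) √5 (fromℕ (F (j N.* k))) ⟩
    √5 ⊗ (fromℕ (2 N.^ k) ⊗ fromℕ (F (j N.* k)))
      ≡⟨ cong (√5 ⊗_) (sym (fromℕ-* (2 N.^ k) (F (j N.* k)))) ⟩
    √5 ⊗ fromℕ (2 N.^ k N.* F (j N.* k)) ∎
    where
    open ≡-Reasoning
    factor : ∀ c x y → (c ⊗ x) ⊖ (c ⊗ y) ≡ c ⊗ (x ⊖ y)
    factor = solve-∀ ℚ√5
    regroup : ∀ a b c → a ⊗ (b ⊗ c) ≡ b ⊗ (a ⊗ c)
    regroup = solve-∀ ℚ√5

EvenSupported OddSupported : (ℕ → Q5) → Set
EvenSupported w = ∀ i → isEven i ≡ false → w i ≡ 𝟘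
OddSupported w = ∀ i → isEven i ≡ true → w i ≡ 𝟘

⊗-EvenSupported : ∀ (c : ℕ → Q5) {w} → EvenSupported w → EvenSupported (λ i → c i ⊗ w i)
⊗-EvenSupported c w-even i i-odd = trans (cong (c i ⊗_) (w-even i i-odd)) (⊗-zeroʳ (c i))

⊗-OddSupported : ∀ (c : ℕ → Q5) {w} → OddSupported w → OddSupported (λ i → c i ⊗ w i)
⊗-OddSupported c w-odd i i-even = trans (cong (c i ⊗_) (w-odd i i-even)) (⊗-zeroʳ (c i))

ΣEven-⋆ : ∀ n (X a w : ℕ → Q5) → EvenSupported w → (∀ k → isEven (n ∸ k) ≡ true → X k ≡ fromℕ (n C k) ⊗ (a k ⊗ w (n ∸ k))) → ΣEven n X ≡ (a ⋆ w) n
ΣEven-⋆ n X a w w-even X≡ = ΣQ5-cong n (λ k _ → drop-filter k (isEven (n ∸ k)) refl)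
  where
  drop-filter : ∀ k b → isEven (n ∸ k) ≡ b → (if b then X k else 𝟘) ≡ fromℕ (n C k) ⊗ (a k ⊗ w (n ∸ k))
  drop-filter k true  even = X≡ k even
  drop-filter k false odd = sym (trans (cong (λ x → fromℕ (n C k) ⊗ (a k ⊗ x)) (w-even (n ∸ k) odd)) (vanish (fromℕ (n C k)) (a k)))
    where
    vanish : ∀ c x → c ⊗ (x ⊗ 𝟘) ≡ 𝟘
    vanish = solve-∀ ℚ√5

ΣOdd-⋆ : ∀ n (X a w : ℕ → Q5) → OddSupported w → (∀ k → isEven (n ∸ k) ≡ false → X k ≡ fromℕ (n C k) ⊗ (a k ⊗ w (n ∸ k))) → ΣOdd n X ≡ (a ⋆ w) n
ΣOdd-⋆ n X a w w-odd X≡ = ΣQ5-cong n (λ k _ → drop-filter k (isEven (n ∸ k)) refl)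
  where
  drop-filter : ∀ k b → isEven (n ∸ k) ≡ b → (if b then 𝟘 else X k) ≡ fromℕ (n C k) ⊗ (a k ⊗ w (n ∸ k))
  drop-filter k false odd = X≡ k odd
  drop-filter k true even = sym (trans (cong (λ x → fromℕ (n C k) ⊗ (a k ⊗ x)) (w-odd (n ∸ k) even)) (vanish (fromℕ (n C k)) (a k)))
    where
    vanish : ∀ c x → c ⊗ (x ⊗ 𝟘) ≡ 𝟘
    vanish = solve-∀ ℚ√5

⊖-^5-even : ∀ x (w : ℕ → Q5) → EvenSupported w → ∀ i → (⊖ x) ^5 i ⊗ w i ≡ x ^5 i ⊗ w i
⊖-^5-even x w w-even i = by-parity (isEven i) refl
  where
  by-parity : ∀ b → isEven i ≡ b → (⊖ x) ^5 i ⊗ w i ≡ x ^5 i ⊗ w i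
  by-parity true i-even = cong (_⊗ w i) (trans (⊖-^5 x i) (trans (cong (_⊗ x ^5 i) (σ-even i i-even)) (⊗-identityˡ (x ^5 i))))
  by-parity false i-odd = trans (cong ((⊖ x) ^5 i ⊗_) (w-even i i-odd)) (trans (⊗-zeroʳ ((⊖ x) ^5 i)) (sym (trans (cong (x ^5 i ⊗_) (w-even i i-odd)) (⊗-zeroʳ (x ^5 i)))))

⋆-linearˡ : ∀ n α β γ (f g h w : ℕ → Q5) →
  ((λ k → (α ⊗ f k ⊕ β ⊗ g k) ⊕ γ ⊗ h k) ⋆ w) n ≡ (α ⊗ (f ⋆ w) n ⊕ β ⊗ (g ⋆ w) n) ⊕ γ ⊗ (h ⋆ w) n
⋆-linearˡ n α β γ f g h w = begin
  ((λ k → (α ⊗ f k ⊕ β ⊗ g k) ⊕ γ ⊗ h k) ⋆ w) n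
    ≡⟨ ⋆-⊕ˡ n (λ k → α ⊗ f k ⊕ β ⊗ g k) (λ k → γ ⊗ h k) w ⟩
  ((λ k → α ⊗ f k ⊕ β ⊗ g k) ⋆ w) n ⊕ ((λ k → γ ⊗ h k) ⋆ w) n
    ≡⟨ cong₂ _⊕_ (trans (⋆-⊕ˡ n (λ k → α ⊗ f k) (λ k → β ⊗ g k) w) (cong₂ _⊕_ (⋆-⊗ˡ n α f w) (⋆-⊗ˡ n β g w))) (⋆-⊗ˡ n γ h w) ⟩
  (α ⊗ (f ⋆ w) n ⊕ β ⊗ (g ⋆ w) n) ⊕ γ ⊗ (h ⋆ w) n ∎
  where open ≡-Reasoning

⋆-linearʳ : ∀ n α β γ (w f g h : ℕ → Q5) →
  (w ⋆ (λ k → (α ⊗ f k ⊕ β ⊗ g k) ⊕ γ ⊗ h k)) n ≡ (α ⊗ (w ⋆ f) n ⊕ β ⊗ (w ⋆ g) n) ⊕ γ ⊗ (w ⋆ h) n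
⋆-linearʳ n α β γ w f g h = begin
  (w ⋆ (λ k → (α ⊗ f k ⊕ β ⊗ g k) ⊕ γ ⊗ h k)) n
    ≡⟨ ⋆-comm n w (λ k → (α ⊗ f k ⊕ β ⊗ g k) ⊕ γ ⊗ h k) ⟩
  ((λ k → (α ⊗ f k ⊕ β ⊗ g k) ⊕ γ ⊗ h k) ⋆ w) n
    ≡⟨ ⋆-linearˡ n α β γ f g h w ⟩
  (α ⊗ (f ⋆ w) n ⊕ β ⊗ (g ⋆ w) n) ⊕ γ ⊗ (h ⋆ w) n
    ≡⟨ cong₂ _⊕_ (cong₂ _⊕_ (cong (α ⊗_) (⋆-comm n f w)) (cong (β ⊗_) (⋆-comm n g w))) (cong (γ ⊗_) (⋆-comm n h w)) ⟩
  (α ⊗ (w ⋆ f) n ⊕ β ⊗ (w ⋆ g) n) ⊕ γ ⊗ (w ⋆ h) n ∎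
  where open ≡-Reasoning

⋆-split : ∀ n u v α β γ (w : ℕ → Q5) → EvenSupported w →
  ((λ k → (α ⊗ (u ⊕ v) ^5 k ⊕ β ⊗ (u ⊖ v) ^5 k) ⊕ γ ⊗ u ^5 k) ⋆ (λ i → v ^5 i ⊗ w i)) n
    ≡ ((u ^5_) ⋆ (λ r → v ^5 r ⊗ ((α ⊕ β ⊗ σ r) ⊗ (w ⋆ 𝟏) r ⊕ γ ⊗ w r))) n
⋆-split n u v α β γ w w-even = begin
  ((λ k → (α ⊗ (u ⊕ v) ^5 k ⊕ β ⊗ (u ⊖ v) ^5 k) ⊕ γ ⊗ u ^5 k) ⋆ vw) n
    ≡⟨ ⋆-linearˡ n α β γ ((u ⊕ v) ^5_) ((u ⊖ v) ^5_) (u ^5_) vw ⟩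
  (α ⊗ (((u ⊕ v) ^5_) ⋆ vw) n ⊕ β ⊗ (((u ⊖ v) ^5_) ⋆ vw) n) ⊕ γ ⊗ ((u ^5_) ⋆ vw) n
    ≡⟨ cong₂ (λ x y → (α ⊗ x ⊕ β ⊗ y) ⊕ γ ⊗ ((u ^5_) ⋆ vw) n) (⋆-transfer n u v w)
             (trans (⋆-congʳ n ((u ⊖ v) ^5_) (λ i _ → sym (⊖-^5-even v w w-even i))) (⋆-transfer n u (⊖ v) w)) ⟩
  (α ⊗ ((u ^5_) ⋆ (λ r → v ^5 r ⊗ W r)) n ⊕ β ⊗ ((u ^5_) ⋆ (λ r → (⊖ v) ^5 r ⊗ W r)) n) ⊕ γ ⊗ ((u ^5_) ⋆ vw) n
    ≡⟨ sym (⋆-linearʳ n α β γ (u ^5_) (λ r → v ^5 r ⊗ W r) (λ r → (⊖ v) ^5 r ⊗ W r) vw) ⟩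
  ((u ^5_) ⋆ (λ r → (α ⊗ (v ^5 r ⊗ W r) ⊕ β ⊗ ((⊖ v) ^5 r ⊗ W r)) ⊕ γ ⊗ (v ^5 r ⊗ w r))) n
    ≡⟨ ⋆-congʳ n (u ^5_) (λ r _ → trans (cong (λ x → (α ⊗ (v ^5 r ⊗ W r) ⊕ β ⊗ (x ⊗ W r)) ⊕ γ ⊗ (v ^5 r ⊗ w r)) (⊖-^5 v r))
                                        (factor α β γ (σ r) (v ^5 r) (W r) (w r))) ⟩
  ((u ^5_) ⋆ (λ r → v ^5 r ⊗ ((α ⊕ β ⊗ σ r) ⊗ W r ⊕ γ ⊗ w r))) n ∎
  where
  open ≡-Reasoning
  vw W : ℕ → Q5
  vw i = v ^5 i ⊗ w i
  W = w ⋆ 𝟏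
  factor : ∀ α β γ s x y z → (α ⊗ (x ⊗ y) ⊕ β ⊗ ((s ⊗ x) ⊗ y)) ⊕ γ ⊗ (x ⊗ z) ≡ x ⊗ ((α ⊕ β ⊗ s) ⊗ y ⊕ γ ⊗ z)
  factor = solve-∀ ℚ√5

⟦ι*⟧⊗ : ∀ c x y d → ⟦ ι c * x * y ⟧ ⊗ d ≡ fromℕ c ⊗ (⟦ x ⟧ ⊗ (d ⊗ ⟦ y ⟧))
⟦ι*⟧⊗ c x y d = begin
  ⟦ ι c * x * y ⟧ ⊗ d                 ≡⟨ cong (_⊗ d) (trans (⟦⟧-* (ι c * x) y) (cong (_⊗ ⟦ y ⟧) (⟦⟧-* (ι c) x))) ⟩
  (fromℕ c ⊗ ⟦ x ⟧) ⊗ ⟦ y ⟧ ⊗ d       ≡⟨ regroup (fromℕ c) ⟦ x ⟧ ⟦ y ⟧ d ⟩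
  fromℕ c ⊗ (⟦ x ⟧ ⊗ (d ⊗ ⟦ y ⟧))     ∎
  where
  open ≡-Reasoning
  regroup : ∀ c x y d → (c ⊗ x) ⊗ y ⊗ d ≡ c ⊗ (x ⊗ (d ⊗ y))
  regroup = solve-∀ ℚ√5

^5⊗δ₀ : ∀ x r → x ^5 r ⊗ δ₀ r ≡ δ₀ r
^5⊗δ₀ x zero = ⊗-identityʳ 𝟙
^5⊗δ₀ x (suc r) = ⊗-zeroʳ (x ^5 suc r)

binomial-pair-top : ∀ n u v s →
  (u ⊕ v) ^5 suc (suc n) ⊕ s ⊗ (u ⊖ v) ^5 suc (suc n)
    ≡ (fromℕ (pronic n) ⊗ (v ⊗ v)) ⊗ ((u ^5_) ⋆ (λ r → (v ^5 r ⊕ s ⊗ (⊖ v) ^5 r) ⊗ 1/ pronic r)) n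
      ⊕ fromℕ (suc (suc n)) ⊗ (u ^5 suc n ⊗ (v ⊕ s ⊗ (⊖ v))) ⊕ u ^5 suc (suc n) ⊗ (𝟙 ⊕ s)
binomial-pair-top n u v s = begin
  (u ⊕ v) ^5 N ⊕ s ⊗ (u ⊖ v) ^5 N
    ≡⟨ cong₂ (λ x y → x ⊕ s ⊗ y) (binomial N u v) (binomial N u (⊖ v)) ⟩
  ((u ^5_) ⋆ (v ^5_)) N ⊕ s ⊗ ((u ^5_) ⋆ ((⊖ v) ^5_)) N
    ≡⟨ sym (trans (⋆-⊕ʳ N (u ^5_) (v ^5_) (λ r → s ⊗ (⊖ v) ^5 r)) (cong (((u ^5_) ⋆ (v ^5_)) N ⊕_) (⋆-⊗ʳ N s (u ^5_) ((⊖ v) ^5_)))) ⟩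
  ((u ^5_) ⋆ A) N
    ≡⟨ ⋆-unfold-top₂ n (u ^5_) A ⟩
  fromℕ (pronic n) ⊗ ((u ^5_) ⋆ (λ r → 1/ pronic r ⊗ A (suc (suc r)))) n ⊕ fromℕ (suc (suc n)) ⊗ (u ^5 suc n ⊗ A 1) ⊕ u ^5 N ⊗ A 0
    ≡⟨ cong₂ (λ x y → x ⊕ fromℕ (suc (suc n)) ⊗ (u ^5 suc n ⊗ y) ⊕ u ^5 N ⊗ (𝟙 ⊕ s ⊗ 𝟙)) low (cong₂ (λ a b → a ⊕ s ⊗ b) (⊗-identityʳ v) (⊗-identityʳ (⊖ v))) ⟩
  (fromℕ (pronic n) ⊗ (v ⊗ v)) ⊗ ((u ^5_) ⋆ (λ r → A r ⊗ 1/ pronic r)) n ⊕ fromℕ (suc (suc n)) ⊗ (u ^5 suc n ⊗ (v ⊕ s ⊗ (⊖ v))) ⊕ u ^5 N ⊗ (𝟙 ⊕ s ⊗ 𝟙)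
    ≡⟨ cong (λ x → (fromℕ (pronic n) ⊗ (v ⊗ v)) ⊗ ((u ^5_) ⋆ (λ r → A r ⊗ 1/ pronic r)) n ⊕ fromℕ (suc (suc n)) ⊗ (u ^5 suc n ⊗ (v ⊕ s ⊗ (⊖ v))) ⊕ u ^5 N ⊗ (𝟙 ⊕ x)) (⊗-identityʳ s) ⟩
  (fromℕ (pronic n) ⊗ (v ⊗ v)) ⊗ ((u ^5_) ⋆ (λ r → A r ⊗ 1/ pronic r)) n ⊕ fromℕ (suc (suc n)) ⊗ (u ^5 suc n ⊗ (v ⊕ s ⊗ (⊖ v))) ⊕ u ^5 N ⊗ (𝟙 ⊕ s) ∎
  where
  open ≡-Reasoning
  N : ℕ
  N = suc (suc n)
  A : ℕ → Q5
  A r = v ^5 r ⊕ s ⊗ (⊖ v) ^5 r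
  shift : ∀ v s x y i → i ⊗ (v ⊗ (v ⊗ x) ⊕ s ⊗ ((⊖ v) ⊗ ((⊖ v) ⊗ y))) ≡ (v ⊗ v) ⊗ ((x ⊕ s ⊗ y) ⊗ i)
  shift = solve-∀ ℚ√5
  low : fromℕ (pronic n) ⊗ ((u ^5_) ⋆ (λ r → 1/ pronic r ⊗ A (suc (suc r)))) n ≡ (fromℕ (pronic n) ⊗ (v ⊗ v)) ⊗ ((u ^5_) ⋆ (λ r → A r ⊗ 1/ pronic r)) n
  low = begin
    fromℕ (pronic n) ⊗ ((u ^5_) ⋆ (λ r → 1/ pronic r ⊗ A (suc (suc r)))) n
      ≡⟨ cong (fromℕ (pronic n) ⊗_) (trans (⋆-congʳ n (u ^5_) (λ r _ → shift v s (v ^5 r) ((⊖ v) ^5 r) (1/ pronic r))) (⋆-⊗ʳ n (v ⊗ v) (u ^5_) (λ r → A r ⊗ 1/ pronic r))) ⟩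
    fromℕ (pronic n) ⊗ ((v ⊗ v) ⊗ ((u ^5_) ⋆ (λ r → A r ⊗ 1/ pronic r)) n)
      ≡⟨ sym (⊗-assoc (fromℕ (pronic n)) (v ⊗ v) _) ⟩
    (fromℕ (pronic n) ⊗ (v ⊗ v)) ⊗ ((u ^5_) ⋆ (λ r → A r ⊗ 1/ pronic r)) n ∎

bern/-weight : ∀ i → ⟦ B (i N.+ 2) /' ι (i N.+ 2) ⟧ ≡ bern/ i
bern/-weight i = trans (cong (λ m → ⟦ B m /' ι m ⟧) (N.+-comm i 2)) (⟦/'⟧ (B (suc (suc i))) (suc (suc i)))

bern/-even : EvenSupported bern/
bern/-even i i-odd = trans (cong (_⊗ 1/ suc (suc i)) (𝔹-odd i i-odd)) (⊗-zeroˡ (1/ suc (suc i)))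

F≢0 : ∀ j → 0 < j → F j ≢ 0
F≢0 (suc j) _ = N.n>0⇒n≢0 (positive j)
  where
  positive : ∀ j → 0 < F (suc j)
  positive zero = s≤s z≤n
  positive (suc j) = N.<-≤-trans (positive j) (N.m≤m+n (F (suc j)) (F j))

*-≢0 : ∀ a b → a ≢ 0 → b ≢ 0 → a N.* b ≢ 0
*-≢0 a b a≢0 b≢0 ab≡0 with N.m*n≡0⇒m≡0∨n≡0 a ab≡0
... | inj₁ a≡0 = a≢0 a≡0
... | inj₂ b≡0 = b≢0 b≡0

1/-cancel : ∀ q y → q ≢ 0 → (fromℕ q ⊗ y) ⊗ 1/ q ≡ y
1/-cancel q y q≢0 = trans (regroup (fromℕ q) y (1/ q)) (trans (cong (y ⊗_) (1/-inverseˡ q q≢0)) (⊗-identityʳ y))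
  where
  regroup : ∀ a y i → (a ⊗ y) ⊗ i ≡ y ⊗ (i ⊗ a)
  regroup = solve-∀ ℚ√5

dupBern/-even : EvenSupported dupBern/
dupBern/-even i i-odd = trans (cong (λ b → ((fromℕ 2 ^5 suc (suc i) ⊗ b) ⊖ b) ⊗ 1/ suc (suc i)) (𝔹-odd i i-odd)) (vanish (fromℕ 2 ^5 suc (suc i)) (1/ suc (suc i)))
  where
  vanish : ∀ p i → ((p ⊗ 𝟘) ⊖ 𝟘) ⊗ i ≡ 𝟘
  vanish = solve-∀ ℚ√5

dupBern/-weight : ∀ i → ⟦ (ι (2 N.^ (i N.+ 2) N.∸ 1) /' ι (i N.+ 2)) * B (i N.+ 2) ⟧ ≡ dupBern/ i
dupBern/-weight i = begin
  ⟦ (ι (2 N.^ (i N.+ 2) N.∸ 1) /' ι (i N.+ 2)) * B (i N.+ 2) ⟧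
    ≡⟨ cong (λ m → ⟦ (ι (2 N.^ m N.∸ 1) /' ι m) * B m ⟧) (N.+-comm i 2) ⟩
  ⟦ (ι (2 N.^ m N.∸ 1) /' ι m) * B m ⟧
    ≡⟨ trans (⟦⟧-* (ι (2 N.^ m N.∸ 1) /' ι m) (B m)) (cong (_⊗ 𝔹 m) (⟦/'⟧ (ι (2 N.^ m N.∸ 1)) m)) ⟩
  (fromℕ (2 N.^ m N.∸ 1) ⊗ 1/ m) ⊗ 𝔹 m
    ≡⟨ cong (λ x → (x ⊗ 1/ m) ⊗ 𝔹 m) 2^m-1 ⟩
  (((fromℕ 2 ^5 m) ⊖ 𝟙) ⊗ 1/ m) ⊗ 𝔹 m
    ≡⟨ regroup (fromℕ 2 ^5 m) (1/ m) (𝔹 m) ⟩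
  dupBern/ i ∎
  where
  open ≡-Reasoning
  m : ℕ
  m = suc (suc i)
  regroup : ∀ p i b → ((p ⊖ 𝟙) ⊗ i) ⊗ b ≡ ((p ⊗ b) ⊖ b) ⊗ i
  regroup = solve-∀ ℚ√5
  2^m-1 : fromℕ (2 N.^ m N.∸ 1) ≡ (fromℕ 2 ^5 m) ⊖ 𝟙
  2^m-1 = begin
    fromℕ (2 N.^ m N.∸ 1)                  ≡⟨ sym (cancel (fromℕ (2 N.^ m N.∸ 1))) ⟩
    (fromℕ (2 N.^ m N.∸ 1) ⊕ 𝟙) ⊖ 𝟙        ≡⟨ cong (_⊖ 𝟙) (sym (fromℕ-+ (2 N.^ m N.∸ 1) 1)) ⟩
    fromℕ (2 N.^ m N.∸ 1 N.+ 1) ⊖ 𝟙        ≡⟨ cong (λ k → fromℕ k ⊖ 𝟙) (N.m∸n+n≡m (N.m^n>0 2 m)) ⟩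
    fromℕ (2 N.^ m) ⊖ 𝟙                    ≡⟨ cong (_⊖ 𝟙) (fromℕ-^ 2 m) ⟩
    (fromℕ 2 ^5 m) ⊖ 𝟙                       ∎
    where
    cancel : ∀ x → (x ⊕ 𝟙) ⊖ 𝟙 ≡ x
    cancel = solve-∀ ℚ√5

oddBern/-odd : OddSupported oddBern/
oddBern/-odd i i-even = cong (λ b → if b then 𝟘 else 𝔹 (suc i) ⊗ 1/ suc i) i-even

1/-unique : ∀ q y → q ≢ 0 → y ⊗ fromℕ q ≡ 𝟙 → y ≡ 1/ q
1/-unique q y q≢0 y⊗q≡𝟙 = begin
  y                           ≡⟨ sym (⊗-identityʳ y) ⟩
  y ⊗ 𝟙                       ≡⟨ cong (y ⊗_) (sym (trans (⊗-comm (fromℕ q) (1/ q)) (1/-inverseˡ q q≢0))) ⟩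
  y ⊗ (fromℕ q ⊗ 1/ q)        ≡⟨ sym (⊗-assoc y (fromℕ q) (1/ q)) ⟩
  (y ⊗ fromℕ q) ⊗ 1/ q        ≡⟨ cong (_⊗ 1/ q) y⊗q≡𝟙 ⟩
  𝟙 ⊗ 1/ q                    ≡⟨ ⊗-identityˡ (1/ q) ⟩
  1/ q                        ∎
  where open ≡-Reasoning

module _ (n j : ℕ) where

  private
    ℓ Δ : Q5
    ℓ = fromℕ (L j)
    Δ = √5 ⊗ fromℕ (F j)
    Q : ℕ
    Q = 5 N.* (n N.+ 1) N.* (n N.+ 2) N.* (F j N.^ 2)

  fromℕ-Q : fromℕ Q ≡ fromℕ (pronic n) ⊗ (Δ ⊗ Δ)
  fromℕ-Q = begin
    fromℕ (5 N.* (n N.+ 1) N.* (n N.+ 2) N.* (F j N.^ 2))   ≡⟨ cong fromℕ (reorder n (F j)) ⟩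
    fromℕ (pronic n N.* (5 N.* (F j N.* F j)))               ≡⟨ trans (fromℕ-* (pronic n) (5 N.* (F j N.* F j))) (cong (fromℕ (pronic n) ⊗_) (trans (fromℕ-* 5 (F j N.* F j)) (cong (fromℕ 5 ⊗_) (fromℕ-* (F j) (F j))))) ⟩
    fromℕ (pronic n) ⊗ (fromℕ 5 ⊗ (fromℕ (F j) ⊗ fromℕ (F j))) ≡⟨ cong (fromℕ (pronic n) ⊗_) (five (fromℕ (F j))) ⟩
    fromℕ (pronic n) ⊗ (Δ ⊗ Δ)                               ∎
    where
    open ≡-Reasoning
    reorder : ∀ n f → 5 N.* (n N.+ 1) N.* (n N.+ 2) N.* (f N.* (f N.* 1)) ≡ suc n N.* suc (suc n) N.* (5 N.* (f N.* f))
    reorder = ℕ-solve-∀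
    five : ∀ f → fromℕ 5 ⊗ (f ⊗ f) ≡ (√5 ⊗ f) ⊗ (√5 ⊗ f)
    five f = trans (cong (_⊗ (f ⊗ f)) (sym √5⊗√5)) (regroup √5 f)
      where
      √5⊗√5 : √5 ⊗ √5 ≡ fromℕ 5
      √5⊗√5 = refl
      regroup : ∀ s f → (s ⊗ s) ⊗ (f ⊗ f) ≡ (s ⊗ f) ⊗ (s ⊗ f)
      regroup = solve-∀ ℚ√5

  Q≢0 : 0 < j → Q ≢ 0
  Q≢0 j>0 = *-≢0 (5 N.* (n N.+ 1) N.* (n N.+ 2)) (F j N.^ 2) (*-≢0 (5 N.* (n N.+ 1)) (n N.+ 2) (*-≢0 5 (n N.+ 1) (λ ()) (N.m+1+n≢0 n)) (N.m+1+n≢0 n)) (λ F²≡0 → F≢0 j j>0 (N.m^n≡0⇒m≡0 (F j) 2 F²≡0))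

  first-identity : 0 < j →
    ΣEven n (λ k → ⟦ ι (n C k) * (ι (2 N.^ k N.* L (j N.* k)) - ι 2 * ι (L j N.^ k)) * (B (n ∸ k N.+ 2) /' ι (n ∸ k N.+ 2)) ⟧ ⊗ ((√5 ⊗ ⟦ ι (F j) ⟧) ^5 (n ∸ k)))
      ≡ ⟦ ((ι (2 N.^ (n N.+ 2) N.* L (j N.* (n N.+ 2))) - ι 2 * ι (L j N.^ (n N.+ 2))) /' ι (5 N.* (n N.+ 1) N.* (n N.+ 2) N.* (F j N.^ 2))) - ι (L j N.^ n) ⟧
  first-identity j>0 = begin
    ΣEven n summand
      ≡⟨ ΣEven-⋆ n summand lucas (λ i → Δ ^5 i ⊗ bern/ i) (⊗-EvenSupported (Δ ^5_) bern/-even) (λ k _ → summand-term k) ⟩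
    (lucas ⋆ (λ i → Δ ^5 i ⊗ bern/ i)) n
      ≡⟨ ⋆-split n ℓ Δ 𝟙 𝟙 (⊖ fromℕ 2) bern/ bern/-even ⟩
    ((ℓ ^5_) ⋆ (λ r → Δ ^5 r ⊗ ((𝟙 ⊕ 𝟙 ⊗ σ r) ⊗ (bern/ ⋆ 𝟏) r ⊕ (⊖ fromℕ 2) ⊗ bern/ r))) n
      ≡⟨ ⋆-congʳ n (ℓ ^5_) (λ r _ → coefficient r) ⟩
    ((ℓ ^5_) ⋆ (λ r → ((Δ ^5 r ⊕ 𝟙 ⊗ (⊖ Δ) ^5 r) ⊗ 1/ pronic r) ⊖ δ₀ r)) n
      ≡⟨ ⋆-⊕ʳ n (ℓ ^5_) (λ r → (Δ ^5 r ⊕ 𝟙 ⊗ (⊖ Δ) ^5 r) ⊗ 1/ pronic r) (λ r → ⊖ δ₀ r) ⟩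
    Y ⊕ ((ℓ ^5_) ⋆ (λ r → ⊖ δ₀ r)) n
      ≡⟨ cong₂ _⊕_ (sym (1/-cancel Q Y (Q≢0 j>0))) (trans (⋆-⊖ʳ n (ℓ ^5_) δ₀) (cong (λ x → ⊖ x) (⋆-identityʳ n (ℓ ^5_)))) ⟩
    ((fromℕ Q ⊗ Y) ⊗ 1/ Q) ⊖ (ℓ ^5 n)
      ≡⟨ cong₂ (λ x y → (x ⊗ 1/ Q) ⊖ y) (sym numerator) (sym (fromℕ-^ (L j) n)) ⟩
    (⟦ numerator-ℚ (n N.+ 2) ⟧ ⊗ 1/ Q) ⊖ fromℕ (L j N.^ n)
      ≡⟨ cong (_⊖ fromℕ (L j N.^ n)) (sym (⟦/'⟧ (numerator-ℚ (n N.+ 2)) Q)) ⟩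
    ⟦ (numerator-ℚ (n N.+ 2) /' ι Q) - ι (L j N.^ n) ⟧ ∎
    where
    open ≡-Reasoning
    Y : Q5
    Y = ((ℓ ^5_) ⋆ (λ r → (Δ ^5 r ⊕ 𝟙 ⊗ (⊖ Δ) ^5 r) ⊗ 1/ pronic r)) n
    numerator-ℚ : ℕ → ℚ
    numerator-ℚ N = ι (2 N.^ N N.* L (j N.* N)) - ι 2 * ι (L j N.^ N)
    numerator : ⟦ numerator-ℚ (n N.+ 2) ⟧ ≡ fromℕ Q ⊗ Y
    numerator = begin
      ⟦ numerator-ℚ (n N.+ 2) ⟧
        ≡⟨ cong (λ N → ⟦ numerator-ℚ N ⟧) (N.+-comm n 2) ⟩
      fromℕ (2 N.^ N N.* L (j N.* N)) ⊖ ⟦ ι 2 * ι (L j N.^ N) ⟧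
        ≡⟨ cong₂ _⊖_ (sym (Lucas-power-sum j N)) (trans (⟦⟧-* (ι 2) (ι (L j N.^ N))) (cong (fromℕ 2 ⊗_) (fromℕ-^ (L j) N))) ⟩
      ((ℓ ⊕ Δ) ^5 N ⊕ (ℓ ⊖ Δ) ^5 N) ⊖ (fromℕ 2 ⊗ ℓ ^5 N)
        ≡⟨ cong (λ m → ((ℓ ⊕ Δ) ^5 N ⊕ m) ⊖ (fromℕ 2 ⊗ ℓ ^5 N)) (sym (⊗-identityˡ ((ℓ ⊖ Δ) ^5 N))) ⟩
      ((ℓ ⊕ Δ) ^5 N ⊕ 𝟙 ⊗ (ℓ ⊖ Δ) ^5 N) ⊖ (fromℕ 2 ⊗ ℓ ^5 N)
        ≡⟨ cong (_⊖ (fromℕ 2 ⊗ ℓ ^5 N)) (binomial-pair-top n ℓ Δ 𝟙) ⟩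
      ((fromℕ (pronic n) ⊗ (Δ ⊗ Δ)) ⊗ Y ⊕ fromℕ N ⊗ (ℓ ^5 suc n ⊗ (Δ ⊕ 𝟙 ⊗ (⊖ Δ))) ⊕ ℓ ^5 N ⊗ (𝟙 ⊕ 𝟙)) ⊖ (fromℕ 2 ⊗ ℓ ^5 N)
        ≡⟨ boundary-vanishes ((fromℕ (pronic n) ⊗ (Δ ⊗ Δ)) ⊗ Y) (fromℕ N) (ℓ ^5 suc n) Δ (ℓ ^5 N) ⟩
      (fromℕ (pronic n) ⊗ (Δ ⊗ Δ)) ⊗ Y
        ≡⟨ cong (_⊗ Y) (sym fromℕ-Q) ⟩
      fromℕ Q ⊗ Y ∎
      where
      N : ℕ
      N = suc (suc n)
      boundary-vanishes : ∀ x c l d m → (x ⊕ c ⊗ (l ⊗ (d ⊕ 𝟙 ⊗ (⊖ d))) ⊕ m ⊗ (𝟙 ⊕ 𝟙)) ⊖ ((𝟙 ⊕ 𝟙) ⊗ m) ≡ x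
      boundary-vanishes = solve-∀ ℚ√5
    lucas : ℕ → Q5
    lucas k = (𝟙 ⊗ (ℓ ⊕ Δ) ^5 k ⊕ 𝟙 ⊗ (ℓ ⊖ Δ) ^5 k) ⊕ (⊖ fromℕ 2) ⊗ ℓ ^5 k
    summand : ℕ → Q5
    summand k = ⟦ ι (n C k) * (ι (2 N.^ k N.* L (j N.* k)) - ι 2 * ι (L j N.^ k)) * (B (n ∸ k N.+ 2) /' ι (n ∸ k N.+ 2)) ⟧ ⊗ Δ ^5 (n ∸ k)
    summand-term : ∀ k → summand k ≡ fromℕ (n C k) ⊗ (lucas k ⊗ (Δ ^5 (n ∸ k) ⊗ bern/ (n ∸ k)))
    summand-term k = trans (⟦ι*⟧⊗ (n C k) _ _ (Δ ^5 (n ∸ k))) (cong₂ (λ a w → fromℕ (n C k) ⊗ (a ⊗ (Δ ^5 (n ∸ k) ⊗ w))) factor (bern/-weight (n ∸ k)))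
      where
      unit : ∀ p m c l → (p ⊕ m) ⊖ (c ⊗ l) ≡ (𝟙 ⊗ p ⊕ 𝟙 ⊗ m) ⊕ (⊖ c) ⊗ l
      unit = solve-∀ ℚ√5
      factor : fromℕ (2 N.^ k N.* L (j N.* k)) ⊖ ⟦ ι 2 * ι (L j N.^ k) ⟧ ≡ lucas k
      factor = trans (cong₂ _⊖_ (sym (Lucas-power-sum j k)) (trans (⟦⟧-* (ι 2) (ι (L j N.^ k))) (cong (fromℕ 2 ⊗_) (fromℕ-^ (L j) k))))
                     (unit ((ℓ ⊕ Δ) ^5 k) ((ℓ ⊖ Δ) ^5 k) (fromℕ 2) (ℓ ^5 k))
    coefficient : ∀ r → Δ ^5 r ⊗ ((𝟙 ⊕ 𝟙 ⊗ σ r) ⊗ (bern/ ⋆ 𝟏) r ⊕ (⊖ fromℕ 2) ⊗ bern/ r) ≡ ((Δ ^5 r ⊕ 𝟙 ⊗ (⊖ Δ) ^5 r) ⊗ 1/ pronic r) ⊖ δ₀ r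
    coefficient r = begin
      Δ ^5 r ⊗ ((𝟙 ⊕ 𝟙 ⊗ σ r) ⊗ (bern/ ⋆ 𝟏) r ⊕ (⊖ fromℕ 2) ⊗ bern/ r)
        ≡⟨ cong (Δ ^5 r ⊗_) (trans (reshape (σ r) ((bern/ ⋆ 𝟏) r) (bern/ r)) (bern/-even-coefficient r)) ⟩
      Δ ^5 r ⊗ (((𝟙 ⊕ σ r) ⊗ 1/ pronic r) ⊖ δ₀ r)
        ≡⟨ expand (Δ ^5 r) (σ r) (1/ pronic r) (δ₀ r) ⟩
      ((Δ ^5 r ⊕ 𝟙 ⊗ (σ r ⊗ Δ ^5 r)) ⊗ 1/ pronic r) ⊖ (Δ ^5 r ⊗ δ₀ r)
        ≡⟨ cong₂ (λ x d → ((Δ ^5 r ⊕ 𝟙 ⊗ x) ⊗ 1/ pronic r) ⊖ d) (sym (⊖-^5 Δ r)) (^5⊗δ₀ Δ r) ⟩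
      ((Δ ^5 r ⊕ 𝟙 ⊗ (⊖ Δ) ^5 r) ⊗ 1/ pronic r) ⊖ δ₀ r ∎
      where
      reshape : ∀ s x b → (𝟙 ⊕ 𝟙 ⊗ s) ⊗ x ⊕ (⊖ fromℕ 2) ⊗ b ≡ ((𝟙 ⊕ s) ⊗ x) ⊖ (fromℕ 2 ⊗ b)
      reshape = solve-∀ ℚ√5
      expand : ∀ d s i e → d ⊗ (((𝟙 ⊕ s) ⊗ i) ⊖ e) ≡ ((d ⊕ 𝟙 ⊗ (s ⊗ d)) ⊗ i) ⊖ (d ⊗ e)
      expand = solve-∀ ℚ√5

  second-identity :
    ΣEven n (λ k → ⟦ ι (n C k) * (ι (2 N.^ k N.* L (j N.* k)) + ι 2 * ι (L j N.^ k)) * ((ι (2 N.^ (n ∸ k N.+ 2) N.∸ 1) /' ι (n ∸ k N.+ 2)) * B (n ∸ k N.+ 2)) ⟧ ⊗ ((√5 ⊗ ⟦ ι (F j) ⟧) ^5 (n ∸ k)))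
      ≡ ⟦ ι (L j N.^ n) ⟧
  second-identity = begin
    ΣEven n summand
      ≡⟨ ΣEven-⋆ n summand lucas (λ i → Δ ^5 i ⊗ dupBern/ i) (⊗-EvenSupported (Δ ^5_) dupBern/-even) (λ k _ → summand-term k) ⟩
    (lucas ⋆ (λ i → Δ ^5 i ⊗ dupBern/ i)) n
      ≡⟨ ⋆-split n ℓ Δ 𝟙 𝟙 (fromℕ 2) dupBern/ dupBern/-even ⟩
    ((ℓ ^5_) ⋆ (λ r → Δ ^5 r ⊗ ((𝟙 ⊕ 𝟙 ⊗ σ r) ⊗ (dupBern/ ⋆ 𝟏) r ⊕ fromℕ 2 ⊗ dupBern/ r))) n
      ≡⟨ ⋆-congʳ n (ℓ ^5_) (λ r _ → coefficient r) ⟩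
    ((ℓ ^5_) ⋆ δ₀) n
      ≡⟨ ⋆-identityʳ n (ℓ ^5_) ⟩
    ℓ ^5 n
      ≡⟨ sym (fromℕ-^ (L j) n) ⟩
    fromℕ (L j N.^ n) ∎
    where
    open ≡-Reasoning
    lucas : ℕ → Q5
    lucas k = (𝟙 ⊗ (ℓ ⊕ Δ) ^5 k ⊕ 𝟙 ⊗ (ℓ ⊖ Δ) ^5 k) ⊕ fromℕ 2 ⊗ ℓ ^5 k
    summand : ℕ → Q5
    summand k = ⟦ ι (n C k) * (ι (2 N.^ k N.* L (j N.* k)) + ι 2 * ι (L j N.^ k)) * ((ι (2 N.^ (n ∸ k N.+ 2) N.∸ 1) /' ι (n ∸ k N.+ 2)) * B (n ∸ k N.+ 2)) ⟧ ⊗ Δ ^5 (n ∸ k)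
    summand-term : ∀ k → summand k ≡ fromℕ (n C k) ⊗ (lucas k ⊗ (Δ ^5 (n ∸ k) ⊗ dupBern/ (n ∸ k)))
    summand-term k = trans (⟦ι*⟧⊗ (n C k) _ _ (Δ ^5 (n ∸ k))) (cong₂ (λ a w → fromℕ (n C k) ⊗ (a ⊗ (Δ ^5 (n ∸ k) ⊗ w))) factor (dupBern/-weight (n ∸ k)))
      where
      unit : ∀ p m c l → (p ⊕ m) ⊕ (c ⊗ l) ≡ (𝟙 ⊗ p ⊕ 𝟙 ⊗ m) ⊕ c ⊗ l
      unit = solve-∀ ℚ√5
      factor : fromℕ (2 N.^ k N.* L (j N.* k)) ⊕ ⟦ ι 2 * ι (L j N.^ k) ⟧ ≡ lucas k
      factor = trans (cong₂ _⊕_ (sym (Lucas-power-sum j k)) (trans (⟦⟧-* (ι 2) (ι (L j N.^ k))) (cong (fromℕ 2 ⊗_) (fromℕ-^ (L j) k))))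
                     (unit ((ℓ ⊕ Δ) ^5 k) ((ℓ ⊖ Δ) ^5 k) (fromℕ 2) (ℓ ^5 k))
    coefficient : ∀ r → Δ ^5 r ⊗ ((𝟙 ⊕ 𝟙 ⊗ σ r) ⊗ (dupBern/ ⋆ 𝟏) r ⊕ fromℕ 2 ⊗ dupBern/ r) ≡ δ₀ r
    coefficient r = trans (cong (Δ ^5 r ⊗_) (trans (reshape (σ r) ((dupBern/ ⋆ 𝟏) r) (dupBern/ r)) (dupBern/-coefficient r))) (^5⊗δ₀ Δ r)
      where
      reshape : ∀ s x e → (𝟙 ⊕ 𝟙 ⊗ s) ⊗ x ⊕ (𝟙 ⊕ 𝟙) ⊗ e ≡ ((𝟙 ⊕ s) ⊗ x) ⊕ ((𝟙 ⊕ 𝟙) ⊗ e)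
      reshape = solve-∀ ℚ√5

  third-identity : 0 < j →
    (ΣEven n (λ k → ⟦ ι (n C k) * ι (2 N.^ k N.* F (j N.* k)) * (B (n ∸ k N.+ 2) /' ι (n ∸ k N.+ 2)) ⟧ ⊗ ((√5 ⊗ ⟦ ι (F j) ⟧) ^5 (n ∸ k)))
      ⊕ (⟦ ι 2 ⟧ ⊗ inv√5) ⊗ ΣOdd n (λ k → ⟦ ι (n C k) * ι (L j N.^ k) * (B (n ∸ k N.+ 1) /' ι (n ∸ k N.+ 1)) ⟧ ⊗ ((√5 ⊗ ⟦ ι (F j) ⟧) ^5 (n ∸ k))))
      ≡ ⟦ (ι (2 N.^ (n N.+ 2) N.* F (j N.* (n N.+ 2))) /' ι (5 N.* (n N.+ 1) N.* (n N.+ 2) N.* (F j N.^ 2))) - (ι (2 N.* (L j N.^ (n N.+ 1))) /' ι (5 N.* (n N.+ 1) N.* F j)) ⟧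
  third-identity j>0 = begin
    ΣEven n even-summand ⊕ (fromℕ 2 ⊗ inv√5) ⊗ ΣOdd n odd-summand
      ≡⟨ cong₂ (λ x y → x ⊕ (fromℕ 2 ⊗ inv√5) ⊗ y)
           (ΣEven-⋆ n even-summand fibonacci (λ i → Δ ^5 i ⊗ bern/ i) (⊗-EvenSupported (Δ ^5_) bern/-even) (λ k _ → even-term k))
           (ΣOdd-⋆ n odd-summand (ℓ ^5_) (λ i → Δ ^5 i ⊗ oddBern/ i) (⊗-OddSupported (Δ ^5_) oddBern/-odd) odd-term) ⟩
    (fibonacci ⋆ (λ i → Δ ^5 i ⊗ bern/ i)) n ⊕ (fromℕ 2 ⊗ inv√5) ⊗ ((ℓ ^5_) ⋆ (λ i → Δ ^5 i ⊗ oddBern/ i)) n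
      ≡⟨ cong (_⊕ (fromℕ 2 ⊗ inv√5) ⊗ ((ℓ ^5_) ⋆ (λ i → Δ ^5 i ⊗ oddBern/ i)) n) (⋆-split n ℓ Δ inv√5 (⊖ inv√5) 𝟘 bern/ bern/-even) ⟩
    ((ℓ ^5_) ⋆ κ) n ⊕ (fromℕ 2 ⊗ inv√5) ⊗ ((ℓ ^5_) ⋆ (λ i → Δ ^5 i ⊗ oddBern/ i)) n
      ≡⟨ sym (trans (⋆-⊕ʳ n (ℓ ^5_) κ (λ r → (fromℕ 2 ⊗ inv√5) ⊗ (Δ ^5 r ⊗ oddBern/ r))) (cong (((ℓ ^5_) ⋆ κ) n ⊕_) (⋆-⊗ʳ n (fromℕ 2 ⊗ inv√5) (ℓ ^5_) (λ i → Δ ^5 i ⊗ oddBern/ i)))) ⟩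
    ((ℓ ^5_) ⋆ (λ r → κ r ⊕ (fromℕ 2 ⊗ inv√5) ⊗ (Δ ^5 r ⊗ oddBern/ r))) n
      ≡⟨ ⋆-congʳ n (ℓ ^5_) (λ r _ → coefficient r) ⟩
    ((ℓ ^5_) ⋆ (λ r → inv√5 ⊗ ((Δ ^5 r ⊕ (⊖ 𝟙) ⊗ (⊖ Δ) ^5 r) ⊗ 1/ pronic r))) n
      ≡⟨ ⋆-⊗ʳ n inv√5 (ℓ ^5_) (λ r → (Δ ^5 r ⊕ (⊖ 𝟙) ⊗ (⊖ Δ) ^5 r) ⊗ 1/ pronic r) ⟩
    inv√5 ⊗ Y
      ≡⟨ sym right-hand-side ⟩
    (fromℕ (2 N.^ (n N.+ 2) N.* F (j N.* (n N.+ 2))) ⊗ 1/ Q) ⊖ (fromℕ (2 N.* (L j N.^ (n N.+ 1))) ⊗ 1/ Q′)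
      ≡⟨ sym (cong₂ _⊖_ (⟦/'⟧ (ι (2 N.^ (n N.+ 2) N.* F (j N.* (n N.+ 2)))) Q) (⟦/'⟧ (ι (2 N.* (L j N.^ (n N.+ 1)))) Q′)) ⟩
    ⟦ (ι (2 N.^ (n N.+ 2) N.* F (j N.* (n N.+ 2))) /' ι Q) - (ι (2 N.* (L j N.^ (n N.+ 1))) /' ι Q′) ⟧ ∎
    where
    open ≡-Reasoning
    Q′ : ℕ
    Q′ = 5 N.* (n N.+ 1) N.* F j
    even-summand odd-summand fibonacci κ : ℕ → Q5
    even-summand k = ⟦ ι (n C k) * ι (2 N.^ k N.* F (j N.* k)) * (B (n ∸ k N.+ 2) /' ι (n ∸ k N.+ 2)) ⟧ ⊗ Δ ^5 (n ∸ k)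
    odd-summand k = ⟦ ι (n C k) * ι (L j N.^ k) * (B (n ∸ k N.+ 1) /' ι (n ∸ k N.+ 1)) ⟧ ⊗ Δ ^5 (n ∸ k)
    fibonacci k = (inv√5 ⊗ (ℓ ⊕ Δ) ^5 k ⊕ (⊖ inv√5) ⊗ (ℓ ⊖ Δ) ^5 k) ⊕ 𝟘 ⊗ ℓ ^5 k
    κ r = Δ ^5 r ⊗ ((inv√5 ⊕ (⊖ inv√5) ⊗ σ r) ⊗ (bern/ ⋆ 𝟏) r ⊕ 𝟘 ⊗ bern/ r)
    Y : Q5
    Y = ((ℓ ^5_) ⋆ (λ r → (Δ ^5 r ⊕ (⊖ 𝟙) ⊗ (⊖ Δ) ^5 r) ⊗ 1/ pronic r)) n
    inv√5⊗√5 : inv√5 ⊗ √5 ≡ 𝟙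
    inv√5⊗√5 = refl
    fibonacci-power : ∀ k → fromℕ (2 N.^ k N.* F (j N.* k)) ≡ inv√5 ⊗ (((ℓ ⊕ Δ) ^5 k) ⊖ ((ℓ ⊖ Δ) ^5 k))
    fibonacci-power k = begin
      fromℕ (2 N.^ k N.* F (j N.* k))                   ≡⟨ sym (⊗-identityˡ (fromℕ (2 N.^ k N.* F (j N.* k)))) ⟩
      𝟙 ⊗ fromℕ (2 N.^ k N.* F (j N.* k))               ≡⟨ cong (_⊗ fromℕ (2 N.^ k N.* F (j N.* k))) (sym inv√5⊗√5) ⟩
      (inv√5 ⊗ √5) ⊗ fromℕ (2 N.^ k N.* F (j N.* k))    ≡⟨ ⊗-assoc inv√5 √5 (fromℕ (2 N.^ k N.* F (j N.* k))) ⟩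
      inv√5 ⊗ (√5 ⊗ fromℕ (2 N.^ k N.* F (j N.* k)))    ≡⟨ cong (inv√5 ⊗_) (sym (Fibonacci-power-difference j k)) ⟩
      inv√5 ⊗ (((ℓ ⊕ Δ) ^5 k) ⊖ ((ℓ ⊖ Δ) ^5 k))         ∎
    even-term : ∀ k → even-summand k ≡ fromℕ (n C k) ⊗ (fibonacci k ⊗ (Δ ^5 (n ∸ k) ⊗ bern/ (n ∸ k)))
    even-term k = trans (⟦ι*⟧⊗ (n C k) _ _ (Δ ^5 (n ∸ k))) (cong₂ (λ a w → fromℕ (n C k) ⊗ (a ⊗ (Δ ^5 (n ∸ k) ⊗ w))) factor (bern/-weight (n ∸ k)))
      where
      spread : ∀ i p m l → i ⊗ (p ⊖ m) ≡ (i ⊗ p ⊕ (⊖ i) ⊗ m) ⊕ 𝟘 ⊗ l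
      spread = solve-∀ ℚ√5
      factor : fromℕ (2 N.^ k N.* F (j N.* k)) ≡ fibonacci k
      factor = trans (fibonacci-power k) (spread inv√5 ((ℓ ⊕ Δ) ^5 k) ((ℓ ⊖ Δ) ^5 k) (ℓ ^5 k))
    odd-term : ∀ k → isEven (n ∸ k) ≡ false → odd-summand k ≡ fromℕ (n C k) ⊗ (ℓ ^5 k ⊗ (Δ ^5 (n ∸ k) ⊗ oddBern/ (n ∸ k)))
    odd-term k odd = trans (⟦ι*⟧⊗ (n C k) _ _ (Δ ^5 (n ∸ k))) (cong₂ (λ a w → fromℕ (n C k) ⊗ (a ⊗ (Δ ^5 (n ∸ k) ⊗ w))) (fromℕ-^ (L j) k) weight)
      where
      weight : ⟦ B (n ∸ k N.+ 1) /' ι (n ∸ k N.+ 1) ⟧ ≡ oddBern/ (n ∸ k)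
      weight = begin
        ⟦ B (n ∸ k N.+ 1) /' ι (n ∸ k N.+ 1) ⟧  ≡⟨ cong (λ m → ⟦ B m /' ι m ⟧) (N.+-comm (n ∸ k) 1) ⟩
        ⟦ B (suc (n ∸ k)) /' ι (suc (n ∸ k)) ⟧  ≡⟨ ⟦/'⟧ (B (suc (n ∸ k))) (suc (n ∸ k)) ⟩
        𝔹 (suc (n ∸ k)) ⊗ 1/ suc (n ∸ k)        ≡⟨ cong (λ b → if b then 𝟘 else 𝔹 (suc (n ∸ k)) ⊗ 1/ suc (n ∸ k)) (sym odd) ⟩
        oddBern/ (n ∸ k)                         ∎
    coefficient : ∀ r → κ r ⊕ (fromℕ 2 ⊗ inv√5) ⊗ (Δ ^5 r ⊗ oddBern/ r) ≡ inv√5 ⊗ ((Δ ^5 r ⊕ (⊖ 𝟙) ⊗ (⊖ Δ) ^5 r) ⊗ 1/ pronic r)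
    coefficient r = begin
      κ r ⊕ (fromℕ 2 ⊗ inv√5) ⊗ (Δ ^5 r ⊗ oddBern/ r)
        ≡⟨ reshape inv√5 (Δ ^5 r) (σ r) ((bern/ ⋆ 𝟏) r) (bern/ r) (oddBern/ r) ⟩
      inv√5 ⊗ (Δ ^5 r ⊗ (((𝟙 ⊖ σ r) ⊗ (bern/ ⋆ 𝟏) r) ⊕ (fromℕ 2 ⊗ oddBern/ r)))
        ≡⟨ cong (λ x → inv√5 ⊗ (Δ ^5 r ⊗ x)) (oddBern/-coefficient r) ⟩
      inv√5 ⊗ (Δ ^5 r ⊗ ((𝟙 ⊖ σ r) ⊗ 1/ pronic r))
        ≡⟨ expand inv√5 (Δ ^5 r) (σ r) (1/ pronic r) ⟩
      inv√5 ⊗ ((Δ ^5 r ⊕ (⊖ 𝟙) ⊗ (σ r ⊗ Δ ^5 r)) ⊗ 1/ pronic r)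
        ≡⟨ cong (λ x → inv√5 ⊗ ((Δ ^5 r ⊕ (⊖ 𝟙) ⊗ x) ⊗ 1/ pronic r)) (sym (⊖-^5 Δ r)) ⟩
      inv√5 ⊗ ((Δ ^5 r ⊕ (⊖ 𝟙) ⊗ (⊖ Δ) ^5 r) ⊗ 1/ pronic r) ∎
      where
      reshape : ∀ i d s x b z → d ⊗ ((i ⊕ (⊖ i) ⊗ s) ⊗ x ⊕ 𝟘 ⊗ b) ⊕ ((𝟙 ⊕ 𝟙) ⊗ i) ⊗ (d ⊗ z) ≡ i ⊗ (d ⊗ (((𝟙 ⊖ s) ⊗ x) ⊕ ((𝟙 ⊕ 𝟙) ⊗ z)))
      reshape = solve-∀ ℚ√5
      expand : ∀ i d s p → i ⊗ (d ⊗ ((𝟙 ⊖ s) ⊗ p)) ≡ i ⊗ ((d ⊕ (⊖ 𝟙) ⊗ (s ⊗ d)) ⊗ p)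
      expand = solve-∀ ℚ√5
    1/Q′ : 1/ Q′ ≡ ((inv√5 ⊗ fromℕ (suc (suc n))) ⊗ Δ) ⊗ 1/ Q
    1/Q′ = sym (1/-unique Q′ _ Q′≢0 (begin
      (((inv√5 ⊗ fromℕ (suc (suc n))) ⊗ Δ) ⊗ 1/ Q) ⊗ fromℕ Q′
        ≡⟨ cong (λ q → (((inv√5 ⊗ fromℕ (suc (suc n))) ⊗ Δ) ⊗ 1/ Q) ⊗ q) fromℕ-Q′ ⟩
      (((inv√5 ⊗ fromℕ (suc (suc n))) ⊗ (√5 ⊗ fromℕ (F j))) ⊗ 1/ Q) ⊗ ((√5 ⊗ √5 ⊗ fromℕ (suc n)) ⊗ fromℕ (F j))
        ≡⟨ regroup inv√5 √5 (fromℕ (suc n)) (fromℕ (suc (suc n))) (fromℕ (F j)) (1/ Q) ⟩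
      (((fromℕ (suc n) ⊗ fromℕ (suc (suc n))) ⊗ (Δ ⊗ Δ)) ⊗ 1/ Q) ⊗ (inv√5 ⊗ √5)
        ≡⟨ cong₂ (λ q i → (q ⊗ 1/ Q) ⊗ i) (trans (cong (_⊗ (Δ ⊗ Δ)) (sym (fromℕ-* (suc n) (suc (suc n))))) (sym fromℕ-Q)) inv√5⊗√5 ⟩
      (fromℕ Q ⊗ 1/ Q) ⊗ 𝟙
        ≡⟨ trans (⊗-identityʳ (fromℕ Q ⊗ 1/ Q)) (trans (⊗-comm (fromℕ Q) (1/ Q)) (1/-inverseˡ Q (Q≢0 j>0))) ⟩
      𝟙 ∎))
      where
      Q′≢0 : Q′ ≢ 0
      Q′≢0 = *-≢0 (5 N.* (n N.+ 1)) (F j) (*-≢0 5 (n N.+ 1) (λ ()) (N.m+1+n≢0 n)) (F≢0 j j>0)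
      fromℕ-Q′ : fromℕ Q′ ≡ (√5 ⊗ √5 ⊗ fromℕ (suc n)) ⊗ fromℕ (F j)
      fromℕ-Q′ = trans (fromℕ-* (5 N.* (n N.+ 1)) (F j)) (cong (_⊗ fromℕ (F j)) (trans (fromℕ-* 5 (n N.+ 1)) (cong (λ m → fromℕ 5 ⊗ fromℕ m) (N.+-comm n 1))))
      regroup : ∀ i s a b f q → (((i ⊗ b) ⊗ (s ⊗ f)) ⊗ q) ⊗ ((s ⊗ s ⊗ a) ⊗ f) ≡ (((a ⊗ b) ⊗ ((s ⊗ f) ⊗ (s ⊗ f))) ⊗ q) ⊗ (i ⊗ s)
      regroup = solve-∀ ℚ√5
    right-hand-side : (fromℕ (2 N.^ (n N.+ 2) N.* F (j N.* (n N.+ 2))) ⊗ 1/ Q) ⊖ (fromℕ (2 N.* (L j N.^ (n N.+ 1))) ⊗ 1/ Q′) ≡ inv√5 ⊗ Y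
    right-hand-side = begin
      (fromℕ (2 N.^ (n N.+ 2) N.* F (j N.* (n N.+ 2))) ⊗ 1/ Q) ⊖ (fromℕ (2 N.* (L j N.^ (n N.+ 1))) ⊗ 1/ Q′)
        ≡⟨ cong₂ (λ N m → (fromℕ (2 N.^ N N.* F (j N.* N)) ⊗ 1/ Q) ⊖ (fromℕ (2 N.* (L j N.^ m)) ⊗ 1/ Q′)) (N.+-comm n 2) (N.+-comm n 1) ⟩
      (fromℕ (2 N.^ N N.* F (j N.* N)) ⊗ 1/ Q) ⊖ (fromℕ (2 N.* (L j N.^ suc n)) ⊗ 1/ Q′)
        ≡⟨ cong₂ (λ x y → (x ⊗ 1/ Q) ⊖ (y ⊗ 1/ Q′)) (fibonacci-power N) (trans (fromℕ-* 2 (L j N.^ suc n)) (cong (fromℕ 2 ⊗_) (fromℕ-^ (L j) (suc n)))) ⟩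
      ((inv√5 ⊗ (((ℓ ⊕ Δ) ^5 N) ⊖ ((ℓ ⊖ Δ) ^5 N))) ⊗ 1/ Q) ⊖ ((fromℕ 2 ⊗ ℓ ^5 suc n) ⊗ 1/ Q′)
        ≡⟨ cong₂ (λ x y → ((inv√5 ⊗ x) ⊗ 1/ Q) ⊖ ((fromℕ 2 ⊗ ℓ ^5 suc n) ⊗ y)) (trans (minus-as-scaled ((ℓ ⊕ Δ) ^5 N) ((ℓ ⊖ Δ) ^5 N)) (binomial-pair-top n ℓ Δ (⊖ 𝟙))) 1/Q′ ⟩
      ((inv√5 ⊗ ((fromℕ (pronic n) ⊗ (Δ ⊗ Δ)) ⊗ Y ⊕ fromℕ N ⊗ (ℓ ^5 suc n ⊗ (Δ ⊕ (⊖ 𝟙) ⊗ (⊖ Δ))) ⊕ ℓ ^5 N ⊗ (𝟙 ⊕ (⊖ 𝟙)))) ⊗ 1/ Q)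
        ⊖ ((fromℕ 2 ⊗ ℓ ^5 suc n) ⊗ (((inv√5 ⊗ fromℕ N) ⊗ Δ) ⊗ 1/ Q))
        ≡⟨ cong (λ q → ((inv√5 ⊗ (q ⊗ Y ⊕ fromℕ N ⊗ (ℓ ^5 suc n ⊗ (Δ ⊕ (⊖ 𝟙) ⊗ (⊖ Δ))) ⊕ ℓ ^5 N ⊗ (𝟙 ⊕ (⊖ 𝟙)))) ⊗ 1/ Q) ⊖ ((fromℕ 2 ⊗ ℓ ^5 suc n) ⊗ (((inv√5 ⊗ fromℕ N) ⊗ Δ) ⊗ 1/ Q))) (sym fromℕ-Q) ⟩
      ((inv√5 ⊗ (fromℕ Q ⊗ Y ⊕ fromℕ N ⊗ (ℓ ^5 suc n ⊗ (Δ ⊕ (⊖ 𝟙) ⊗ (⊖ Δ))) ⊕ ℓ ^5 N ⊗ (𝟙 ⊕ (⊖ 𝟙)))) ⊗ 1/ Q)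
        ⊖ ((fromℕ 2 ⊗ ℓ ^5 suc n) ⊗ (((inv√5 ⊗ fromℕ N) ⊗ Δ) ⊗ 1/ Q))
        ≡⟨ boundary-cancels inv√5 (fromℕ Q) Y (fromℕ N) (ℓ ^5 suc n) Δ (ℓ ^5 N) (1/ Q) ⟩
      inv√5 ⊗ ((fromℕ Q ⊗ Y) ⊗ 1/ Q)
        ≡⟨ cong (inv√5 ⊗_) (1/-cancel Q Y (Q≢0 j>0)) ⟩
      inv√5 ⊗ Y ∎
      where
      N : ℕ
      N = suc (suc n)
      minus-as-scaled : ∀ p m → p ⊖ m ≡ p ⊕ (⊖ 𝟙) ⊗ m
      minus-as-scaled = solve-∀ ℚ√5
      boundary-cancels : ∀ i q y c l d m t →
        ((i ⊗ (q ⊗ y ⊕ c ⊗ (l ⊗ (d ⊕ (⊖ 𝟙) ⊗ (⊖ d))) ⊕ m ⊗ (𝟙 ⊕ (⊖ 𝟙)))) ⊗ t) ⊖ (((𝟙 ⊕ 𝟙) ⊗ l) ⊗ (((i ⊗ c) ⊗ d) ⊗ t)) ≡ i ⊗ ((q ⊗ y) ⊗ t)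
      boundary-cancels = solve-∀ ℚ√5

theorem2 : (n j : ℕ) → 0 < n → 0 < j →
    (ΣEven n (λ k → ⟦ ι (n C k) * (ι (2 N.^ k N.* L (j N.* k)) - ι 2 * ι (L j N.^ k)) * (B (n ∸ k N.+ 2) /' ι (n ∸ k N.+ 2)) ⟧ ⊗ ((√5 ⊗ ⟦ ι (F j) ⟧) ^5 (n ∸ k)))
      ≡ ⟦ ((ι (2 N.^ (n N.+ 2) N.* L (j N.* (n N.+ 2))) - ι 2 * ι (L j N.^ (n N.+ 2))) /' ι (5 N.* (n N.+ 1) N.* (n N.+ 2) N.* (F j N.^ 2))) - ι (L j N.^ n) ⟧)
    × (ΣEven n (λ k → ⟦ ι (n C k) * (ι (2 N.^ k N.* L (j N.* k)) + ι 2 * ι (L j N.^ k)) * ((ι (2 N.^ (n ∸ k N.+ 2) N.∸ 1) /' ι (n ∸ k N.+ 2)) * B (n ∸ k N.+ 2)) ⟧ ⊗ ((√5 ⊗ ⟦ ι (F j) ⟧) ^5 (n ∸ k)))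
      ≡ ⟦ ι (L j N.^ n) ⟧)
    × ((ΣEven n (λ k → ⟦ ι (n C k) * ι (2 N.^ k N.* F (j N.* k)) * (B (n ∸ k N.+ 2) /' ι (n ∸ k N.+ 2)) ⟧ ⊗ ((√5 ⊗ ⟦ ι (F j) ⟧) ^5 (n ∸ k)))
        ⊕ (⟦ ι 2 ⟧ ⊗ inv√5) ⊗ ΣOdd n (λ k → ⟦ ι (n C k) * ι (L j N.^ k) * (B (n ∸ k N.+ 1) /' ι (n ∸ k N.+ 1)) ⟧ ⊗ ((√5 ⊗ ⟦ ι (F j) ⟧) ^5 (n ∸ k))))
      ≡ ⟦ (ι (2 N.^ (n N.+ 2) N.* F (j N.* (n N.+ 2))) /' ι (5 N.* (n N.+ 1) N.* (n N.+ 2) N.* (F j N.^ 2))) - (ι (2 N.* (L j N.^ (n N.+ 1))) /' ι (5 N.* (n N.+ 1) N.* F j)) ⟧)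
theorem2 n j _ j>0 = first-identity n j j>0 , second-identity n j , third-identity n j j>0
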